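{- Let $q_1,q_2$ be natural integers with $q_1\neq q_2$. For a prime $p$, let $\mathrm{Ma}_{q_1,q_2,p}=\sum_{x\bmod p}\max(q_1x,q_2x)$, where $q_1x$ and $q_2x$ denote the representatives modulo $p$ lying in $[1,p]$. Then, as $p\to\infty$ through primes, $$\mathrm{Ma}_{q_1,q_2,p}=p^2\left(\frac23-\frac{\gcd(q_1,q_2)^2}{12q_1q_2}\right)(1+o(1)).$$ -}

module Defs where

open import Data.Nat using (ℕ; zero; suc; _*_; _⊔_; NonZero)
open import Data.Nat.DivMod using (_%_)
open import Data.Nat.GCD using (gcd)
open import Data.Nat.Properties using (m*n≢0)
open import Data.List using (map; upTo)
open import Data.Nat.ListAction using (sum)
open import Data.Integer using (+_)
open import Data.Rational using (ℚ; _-_; _/_)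

rep : (m n : ℕ) → .{{NonZero m}} → ℕ
rep m n {{nz}} with n % m
... | zero  = m
... | suc r = suc r

-- Ma_{q1,q2,p} = Σ_{x mod p} max(q1 x, q2 x), x running over 0,…,p-1,
-- with q_i x the representative in [1,p].  (Value 0 for p = 0, never used.)
Ma : (q₁ q₂ p : ℕ) → ℕ
Ma q₁ q₂ zero    = 0
Ma q₁ q₂ (suc k) = sum (map (λ x → rep (suc k) (q₁ * x) ⊔ rep (suc k) (q₂ * x)) (upTo (suc k)))

mainConst : (q₁ q₂ : ℕ) → .{{NonZero q₁}} → .{{NonZero q₂}} → ℚ
mainConst q₁ q₂ {{n₁}} {{n₂}} =
  (+ 2 / 3) - (+ (gcd q₁ q₂ * gcd q₁ q₂) / (12 * q₁ * q₂))
  where instance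
    nz : NonZero (12 * q₁ * q₂)
    nz = m*n≢0 (12 * q₁) q₂ {{m*n≢0 12 q₁}}

-- Write q₁ = a g and q₂ = b g with a, b coprime and let p > q₁ + q₂ be prime. Multiplication by g
-- permutes the residues mod p, so Ma = p + ∑ₓ max(u, v) with u = a x mod p and v = b x mod p. As
-- max(u, v) = (u + v + |u - v|) / 2 and u - v ≡ (a - b) x, summing over the permuted residues reduces
-- everything to T = ∑ₓ u v. Writing u = a x - p ⌊a x / p⌋ and counting lattice points under the lines
-- y = i p / a and y = j p / b shows T = (1/4 + 1/(12ab)) p³ + O(p²); the constant comes from the exact
-- value of ∑_{0<i<a, 0<j<b} max(i b, j a), a polynomial in a and b since a and b are coprime. All
-- estimates are made in ℕ, with x ≈[ e ] y meaning |x - y| ≤ e, and only the last step moves to ℚ.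
module Submission where

open import Data.Nat
open import Data.Nat.Properties
open import Algebra.Properties.CommutativeSemigroup +-commutativeSemigroup using (interchange)
open import Data.Nat.DivMod
open import Data.Nat.Divisibility using (_∣_; divides; ∣⇒≤; m%n≡0⇒n∣m)
open import Data.Nat.GCD using (gcd; gcd[m,n]∣m; gcd[m,n]∣n; gcd[m,n]≢0; m/gcd[m,n]≢0; n/gcd[m,n]≢0)
open import Data.Nat.Coprimality using (Coprime; coprime-divisor; coprime-/gcd; prime⇒coprime)
open import Data.Nat.Primality using (Prime)
open import Data.Nat.ListAction using (sum)
open import Data.Nat.Tactic.RingSolver using (solve-∀)
open import Data.List using (map; upTo; applyUpTo)
import Data.Integer as ℤ
import Data.Integer.Properties as ℤ
open import Data.Rational as ℚ using (ℚ; mkℚ; 0ℚ; 1ℚ; toℚᵘ)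
import Data.Rational.Properties as ℚ
open import Data.Rational.Solver using (module +-*-Solver)
open import Data.Rational.Unnormalised as ℚᵘ using (mkℚᵘ; *≡*; *≤*)
import Data.Rational.Unnormalised.Properties as ℚᵘ
open import Data.Empty using (⊥-elim)
open import Data.Product using (Σ; ∃-syntax; _,_)
open import Data.Sum using (_⊎_; inj₁; inj₂)
open import Function.Base using (_∘_; id)
open import Function.Bundles using (_⇔_; mk⇔; Equivalence)
open import Relation.Binary.PropositionalEquality
open import Relation.Nullary using (yes; no)
open import Defs

∑ : ℕ → (ℕ → ℕ) → ℕ
∑ zero    f = 0
∑ (suc n) f = ∑ n f + f n

syntax ∑ n (λ x → e) = ∑[ x < n ] e

∑-cong : ∀ n {f g : ℕ → ℕ} → (∀ x → x < n → f x ≡ g x) → ∑ n f ≡ ∑ n g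
∑-cong zero    f≡g = refl
∑-cong (suc n) f≡g = cong₂ _+_ (∑-cong n (λ x x<n → f≡g x (m<n⇒m<1+n x<n))) (f≡g n ≤-refl)

∑-mono-≤ : ∀ n {f g : ℕ → ℕ} → (∀ x → x < n → f x ≤ g x) → ∑ n f ≤ ∑ n g
∑-mono-≤ zero    f≤g = z≤n
∑-mono-≤ (suc n) f≤g = +-mono-≤ (∑-mono-≤ n (λ x x<n → f≤g x (m<n⇒m<1+n x<n))) (f≤g n ≤-refl)

∑-const : ∀ n c → ∑[ _ < n ] c ≡ n * c
∑-const zero    c = refl
∑-const (suc n) c = trans (cong (_+ c) (∑-const n c)) (+-comm (n * c) c)

∑-count : ∀ n → ∑[ _ < n ] 1 ≡ n
∑-count n = trans (∑-const n 1) (*-identityʳ n)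

∑-zero : ∀ n {f : ℕ → ℕ} → (∀ x → x < n → f x ≡ 0) → ∑ n f ≡ 0
∑-zero n f≡0 = trans (∑-cong n f≡0) (trans (∑-const n 0) (*-zeroʳ n))

∑-distrib-+ : ∀ n (f g : ℕ → ℕ) → ∑[ x < n ] (f x + g x) ≡ ∑ n f + ∑ n g
∑-distrib-+ zero    f g = refl
∑-distrib-+ (suc n) f g =
  trans (cong (_+ (f n + g n)) (∑-distrib-+ n f g)) (interchange (∑ n f) (∑ n g) (f n) (g n))

∑-distribˡ : ∀ n k (f : ℕ → ℕ) → ∑[ x < n ] (k * f x) ≡ k * ∑ n f
∑-distribˡ zero    k f = sym (*-zeroʳ k)
∑-distribˡ (suc n) k f =
  trans (cong (_+ k * f n) (∑-distribˡ n k f)) (sym (*-distribˡ-+ k (∑ n f) (f n)))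

∑-distribʳ : ∀ n k (f : ℕ → ℕ) → ∑[ x < n ] (f x * k) ≡ ∑ n f * k
∑-distribʳ n k f =
  trans (∑-cong n (λ x _ → *-comm (f x) k)) (trans (∑-distribˡ n k f) (*-comm k (∑ n f)))

∑-*-∑ : ∀ m n (f g : ℕ → ℕ) → ∑[ x < m ] ∑[ y < n ] (f x * g y) ≡ ∑ m f * ∑ n g
∑-*-∑ m n f g = trans (∑-cong m (λ x _ → ∑-distribˡ n (f x) g)) (∑-distribʳ m (∑ n g) f)

∑-suc : ∀ n (f : ℕ → ℕ) → ∑ (suc n) f ≡ f 0 + ∑[ x < n ] f (suc x)
∑-suc zero    f = +-comm 0 (f 0)
∑-suc (suc n) f = trans (cong (_+ f (suc n)) (∑-suc n f)) (+-assoc (f 0) _ _)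

∑-split : ∀ m n (f : ℕ → ℕ) → ∑ (m + n) f ≡ ∑ m f + ∑[ x < n ] f (m + x)
∑-split m zero    f = trans (cong (λ k → ∑ k f) (+-identityʳ m)) (sym (+-identityʳ _))
∑-split m (suc n) f = begin
  ∑ (m + suc n) f                            ≡⟨ cong (λ k → ∑ k f) (+-suc m n) ⟩
  ∑ (m + n) f + f (m + n)                    ≡⟨ cong (_+ f (m + n)) (∑-split m n f) ⟩
  ∑ m f + ∑[ x < n ] f (m + x) + f (m + n)   ≡⟨ +-assoc (∑ m f) _ _ ⟩
  ∑ m f + (∑[ x < n ] f (m + x) + f (m + n)) ∎
  where open ≡-Reasoning

∑-blocks : ∀ m n (f : ℕ → ℕ) → ∑ (m * n) f ≡ ∑[ t < m ] ∑[ r < n ] f (t * n + r)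
∑-blocks zero    n f = refl
∑-blocks (suc m) n f = begin
  ∑ (n + m * n) f                                                ≡⟨ cong (λ k → ∑ k f) (+-comm n (m * n)) ⟩
  ∑ (m * n + n) f                                                ≡⟨ ∑-split (m * n) n f ⟩
  ∑ (m * n) f + ∑[ r < n ] f (m * n + r)                         ≡⟨ cong (_+ ∑[ r < n ] f (m * n + r)) (∑-blocks m n f) ⟩
  ∑[ t < m ] ∑[ r < n ] f (t * n + r) + ∑[ r < n ] f (m * n + r) ∎
  where open ≡-Reasoning

∑-comm : ∀ m n (f : ℕ → ℕ → ℕ) → ∑[ x < m ] ∑[ y < n ] f x y ≡ ∑[ y < n ] ∑[ x < m ] f x y
∑-comm zero    n f = sym (∑-zero n (λ _ _ → refl))
∑-comm (suc m) n f =
  trans (cong (_+ ∑[ y < n ] f m y) (∑-comm m n f))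
        (sym (∑-distrib-+ n (λ y → ∑[ x < m ] f x y) (f m)))

sum-upTo : ∀ n (f : ℕ → ℕ) → sum (map f (upTo n)) ≡ ∑ n f
sum-upTo n f = go n id
  where
  go : ∀ n (g : ℕ → ℕ) → sum (map f (applyUpTo g n)) ≡ ∑[ x < n ] f (g x)
  go zero    g = refl
  go (suc n) g = trans (cong (f (g 0) +_) (go n (λ x → g (suc x)))) (sym (∑-suc n (λ x → f (g x))))

∑-≤-≡⇒≡ : ∀ n {f g : ℕ → ℕ} → (∀ x → x < n → f x ≤ g x) → ∑ n f ≡ ∑ n g →
          ∀ x → x < n → f x ≡ g x
∑-≤-≡⇒≡ (suc n) {f} {g} f≤g eq x x<1+n with m<1+n⇒m<n∨m≡n x<1+n
... | inj₁ x<n = ∑-≤-≡⇒≡ n (λ y y<n → f≤g y (m<n⇒m<1+n y<n)) init x x<n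
  where
  init : ∑ n f ≡ ∑ n g
  init = ≤-antisym (∑-mono-≤ n (λ y y<n → f≤g y (m<n⇒m<1+n y<n)))
           (+-cancelʳ-≤ (g n) _ _ (≤-trans (≤-reflexive (sym eq)) (+-monoʳ-≤ (∑ n f) (f≤g n ≤-refl))))
... | inj₂ refl = ≤-antisym (f≤g x ≤-refl)
       (+-cancelˡ-≤ (∑ x f) _ _ (≤-trans (+-monoˡ-≤ (g x) (∑-mono-≤ x (λ y y<x → f≤g y (m<n⇒m<1+n y<x))))
                                          (≤-reflexive (sym eq))))

δ : ℕ → ℕ → ℕ
δ y z with y ≟ z
... | yes _ = 1
... | no  _ = 0

δ-refl : ∀ y → δ y y ≡ 1
δ-refl y with y ≟ y
... | yes _   = refl
... | no y≢y = ⊥-elim (y≢y refl)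

δ-≢ : ∀ {y z} → y ≢ z → δ y z ≡ 0
δ-≢ {y} {z} y≢z with y ≟ z
... | yes y≡z = ⊥-elim (y≢z y≡z)
... | no  _   = refl

∑-δ : ∀ n z (f : ℕ → ℕ) → z < n → ∑[ y < n ] (δ z y * f y) ≡ f z
∑-δ (suc n) z f z<1+n with m<1+n⇒m<n∨m≡n z<1+n
... | inj₁ z<n  = trans (cong₂ _+_ (∑-δ n z f z<n) (cong (_* f n) (δ-≢ (<⇒≢ z<n)))) (+-identityʳ (f z))
... | inj₂ refl = cong₂ _+_ (∑-zero z (λ y y<z → cong (_* f y) (δ-≢ (>⇒≢ y<z))))
                            (trans (cong (_* f z) (δ-refl z)) (+-identityʳ (f z)))

MapsTo : ℕ → (ℕ → ℕ) → Set
MapsTo n σ = ∀ x → x < n → σ x < n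

InjectiveOn : ℕ → (ℕ → ℕ) → Set
InjectiveOn n σ = ∀ x y → x < n → y < n → σ x ≡ σ y → x ≡ y

fibre-≤1 : ∀ n (σ : ℕ → ℕ) → InjectiveOn n σ → ∀ y → ∑[ x < n ] δ (σ x) y ≤ 1
fibre-≤1 zero    σ inj y = z≤n
fibre-≤1 (suc n) σ inj y with σ n ≟ y
... | yes σn≡y = ≤-reflexive (cong (_+ 1) (∑-zero n (λ x x<n → δ-≢ (λ σx≡y →
                   <⇒≢ x<n (inj x n (m<n⇒m<1+n x<n) ≤-refl (trans σx≡y (sym σn≡y)))))))
... | no  _    = ≤-trans (≤-reflexive (+-identityʳ _))
                   (fibre-≤1 n σ (λ x z x<n z<n → inj x z (m<n⇒m<1+n x<n) (m<n⇒m<1+n z<n)) y)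

-- Each fibre has at most one point, and the fibres over [0, n) partition the n points of [0, n).
∑-permute : ∀ n (σ f : ℕ → ℕ) → MapsTo n σ → InjectiveOn n σ → ∑[ x < n ] f (σ x) ≡ ∑ n f
∑-permute n σ f into inj = begin
  ∑[ x < n ] f (σ x)                      ≡⟨ ∑-cong n (λ x x<n → sym (∑-δ n (σ x) f (into x x<n))) ⟩
  ∑[ x < n ] ∑[ y < n ] (δ (σ x) y * f y) ≡⟨ ∑-comm n n (λ x y → δ (σ x) y * f y) ⟩
  ∑[ y < n ] ∑[ x < n ] (δ (σ x) y * f y) ≡⟨ ∑-cong n (λ y _ → ∑-distribʳ n (f y) (λ x → δ (σ x) y)) ⟩
  ∑[ y < n ] (fibre y * f y)              ≡⟨ ∑-cong n (λ y y<n → trans (cong (_* f y) (fibre≡1 y y<n)) (*-identityˡ (f y))) ⟩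
  ∑ n f                                   ∎
  where
  open ≡-Reasoning
  fibre : ℕ → ℕ
  fibre y = ∑[ x < n ] δ (σ x) y
  total : ∑ n fibre ≡ ∑[ _ < n ] 1
  total = begin
    ∑[ y < n ] ∑[ x < n ] δ (σ x) y ≡⟨ ∑-comm n n (λ x y → δ (σ x) y) ⟨
    ∑[ x < n ] ∑[ y < n ] δ (σ x) y ≡⟨ ∑-cong n (λ x x<n → trans (∑-cong n (λ y _ → sym (*-identityʳ (δ (σ x) y))))
                                                                          (∑-δ n (σ x) (λ _ → 1) (into x x<n))) ⟩
    ∑[ _ < n ] 1                              ∎
  fibre≡1 : ∀ y → y < n → fibre y ≡ 1
  fibre≡1 = ∑-≤-≡⇒≡ n (λ y _ → fibre-≤1 n σ inj y) total

%≡%⇒∣∸ : ∀ m k n .{{_ : NonZero n}} → m % n ≡ k % n → m ≤ k → n ∣ k ∸ m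
%≡%⇒∣∸ m k n m%n≡k%n m≤k = divides (k / n ∸ m / n) (begin
  k ∸ m                                     ≡⟨ cong₂ _∸_ (m≡m%n+[m/n]*n k n) (m≡m%n+[m/n]*n m n) ⟩
  (k % n + k / n * n) ∸ (m % n + m / n * n) ≡⟨ cong (λ r → (k % n + k / n * n) ∸ (r + m / n * n)) m%n≡k%n ⟩
  (k % n + k / n * n) ∸ (k % n + m / n * n) ≡⟨ [m+n]∸[m+o]≡n∸o (k % n) _ _ ⟩
  k / n * n ∸ m / n * n                     ≡⟨ *-distribʳ-∸ n (k / n) (m / n) ⟨
  (k / n ∸ m / n) * n                       ∎)
  where open ≡-Reasoning

∣∧<⇒≡0 : ∀ {n d} → n ∣ d → d < n → d ≡ 0
∣∧<⇒≡0 {d = zero}  _   _   = refl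
∣∧<⇒≡0 {d = suc d} n∣d d<n = ⊥-elim (<⇒≱ d<n (∣⇒≤ n∣d))

injectiveOn-mod : ∀ n (σ : ℕ → ℕ) →
  (∀ x y → x ≤ y → σ x ≡ σ y → n ∣ y ∸ x) → InjectiveOn n σ
injectiveOn-mod n σ div x y x<n y<n σx≡σy with ≤-total x y
... | inj₁ x≤y = ≤-antisym x≤y (m∸n≡0⇒m≤n (∣∧<⇒≡0 (div x y x≤y σx≡σy) (≤-<-trans (m∸n≤m y x) y<n)))
... | inj₂ y≤x = sym (≤-antisym y≤x (m∸n≡0⇒m≤n (∣∧<⇒≡0 (div y x y≤x (sym σx≡σy)) (≤-<-trans (m∸n≤m x y) x<n))))

∑-permute-affine : ∀ n .{{_ : NonZero n}} q s (f : ℕ → ℕ) → Coprime n q →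
                   ∑[ x < n ] f ((s + q * x) % n) ≡ ∑ n f
∑-permute-affine n q s f n⊥q =
  ∑-permute n (λ x → (s + q * x) % n) f (λ x _ → m%n<n (s + q * x) n) (injectiveOn-mod n _ div)
  where
  div : ∀ x y → x ≤ y → (s + q * x) % n ≡ (s + q * y) % n → n ∣ y ∸ x
  div x y x≤y eq = coprime-divisor n⊥q (subst (n ∣_) difference (%≡%⇒∣∸ _ _ n eq (+-monoʳ-≤ s (*-monoʳ-≤ q x≤y))))
    where
    difference : (s + q * y) ∸ (s + q * x) ≡ q * (y ∸ x)
    difference = trans ([m+n]∸[m+o]≡n∸o s (q * y) (q * x)) (sym (*-distribˡ-∸ q y x))

⟦_≤_⟧ : ℕ → ℕ → ℕ
⟦ zero  ≤ n     ⟧ = 1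
⟦ suc m ≤ zero  ⟧ = 0
⟦ suc m ≤ suc n ⟧ = ⟦ m ≤ n ⟧

⟦≤⟧-true : ∀ {m n} → m ≤ n → ⟦ m ≤ n ⟧ ≡ 1
⟦≤⟧-true {zero}            _         = refl
⟦≤⟧-true {suc m} {suc n} (s≤s m≤n) = ⟦≤⟧-true m≤n

⟦≤⟧-false : ∀ {m n} → n < m → ⟦ m ≤ n ⟧ ≡ 0
⟦≤⟧-false {suc m} {zero}  _         = refl
⟦≤⟧-false {suc m} {suc n} (s≤s n<m) = ⟦≤⟧-false n<m

⟦≤⟧-cong : ∀ {m n m′ n′} → (m ≤ n ⇔ m′ ≤ n′) → ⟦ m ≤ n ⟧ ≡ ⟦ m′ ≤ n′ ⟧
⟦≤⟧-cong {m} {n} m≤n⇔ with m ≤? n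
... | yes m≤n = trans (⟦≤⟧-true m≤n) (sym (⟦≤⟧-true (Equivalence.to m≤n⇔ m≤n)))
... | no  m≰n = trans (⟦≤⟧-false (≰⇒> m≰n)) (sym (⟦≤⟧-false (≰⇒> (m≰n ∘ Equivalence.from m≤n⇔))))

⟦⊔≤⟧ : ∀ c d x → ⟦ c ≤ x ⟧ * ⟦ d ≤ x ⟧ ≡ ⟦ c ⊔ d ≤ x ⟧
⟦⊔≤⟧ c d x with c ≤? x | d ≤? x
... | yes c≤x | yes d≤x rewrite ⟦≤⟧-true c≤x | ⟦≤⟧-true d≤x | ⟦≤⟧-true (⊔-lub c≤x d≤x) = refl
... | no  c≰x | _
  rewrite ⟦≤⟧-false (≰⇒> c≰x) | ⟦≤⟧-false (<-≤-trans (≰⇒> c≰x) (m≤m⊔n c d)) = refl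
... | yes c≤x | no  d≰x
  rewrite ⟦≤⟧-true c≤x | ⟦≤⟧-false (≰⇒> d≰x) | ⟦≤⟧-false (<-≤-trans (≰⇒> d≰x) (m≤n⊔m c d)) = refl

∑-restrict : ∀ c n (f : ℕ → ℕ) → c ≤ n → ∑[ x < n ] (⟦ c ≤ x ⟧ * f x) + ∑ c f ≡ ∑ n f
∑-restrict c n f c≤n = begin
  ∑[ x < n ] (⟦ c ≤ x ⟧ * f x) + ∑ c f
    ≡⟨ cong (λ k → ∑[ x < k ] (⟦ c ≤ x ⟧ * f x) + ∑ c f) n≡c+l ⟩
  ∑[ x < c + l ] (⟦ c ≤ x ⟧ * f x) + ∑ c f                   ≡⟨ cong (_+ ∑ c f) (∑-split c l _) ⟩
  ∑[ x < c ] (⟦ c ≤ x ⟧ * f x) + ∑[ r < l ] (⟦ c ≤ c + r ⟧ * f (c + r)) + ∑ c f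
    ≡⟨ cong₂ (λ u v → u + v + ∑ c f) (∑-zero c (λ x x<c → cong (_* f x) (⟦≤⟧-false x<c)))
                                      (∑-cong l (λ r _ → trans (cong (_* f (c + r)) (⟦≤⟧-true (m≤m+n c r))) (*-identityˡ _))) ⟩
  ∑[ r < l ] f (c + r) + ∑ c f ≡⟨ +-comm _ (∑ c f) ⟩
  ∑ c f + ∑[ r < l ] f (c + r) ≡⟨ ∑-split c l f ⟨
  ∑ (c + l) f                  ≡⟨ cong (λ k → ∑ k f) n≡c+l ⟨
  ∑ n f                        ∎
  where
  open ≡-Reasoning
  l = n ∸ c
  n≡c+l : n ≡ c + l
  n≡c+l = sym (m+[n∸m]≡n c≤n)

count-≥ : ∀ c n → c ≤ n → ∑[ x < n ] ⟦ c ≤ x ⟧ + c ≡ n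
count-≥ c n c≤n = begin
  ∑[ x < n ] ⟦ c ≤ x ⟧ + c
    ≡⟨ cong₂ _+_ (∑-cong n (λ x _ → sym (*-identityʳ ⟦ c ≤ x ⟧))) (sym (∑-count c)) ⟩
  ∑[ x < n ] (⟦ c ≤ x ⟧ * 1) + ∑[ _ < c ] 1 ≡⟨ ∑-restrict c n (λ _ → 1) c≤n ⟩
  ∑[ _ < n ] 1                              ≡⟨ ∑-count n ⟩
  n                                         ∎
  where open ≡-Reasoning

count-≤ : ∀ q n → q < n → ∑[ i < n ] ⟦ i ≤ q ⟧ ≡ suc q
count-≤ q (suc n) q<1+n with q ≟ n
... | yes refl = trans (cong₂ _+_ (trans (∑-cong q (λ i i<q → ⟦≤⟧-true (<⇒≤ i<q))) (∑-count q))
                                  (⟦≤⟧-true (≤-refl {q})))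
                       (+-comm q 1)
... | no  q≢n  = trans (cong₂ _+_ (count-≤ q n q<n) (⟦≤⟧-false q<n)) (+-identityʳ (suc q))
  where q<n = ≤∧≢⇒< (s≤s⁻¹ q<1+n) q≢n

*≤⇔≤/ : ∀ i m k .{{_ : NonZero m}} → (i * m ≤ k ⇔ i ≤ k / m)
*≤⇔≤/ i m k = mk⇔ (λ i*m≤k → subst (_≤ k / m) (m*n/n≡m i m) (/-monoˡ-≤ m i*m≤k))
                   (λ i≤k/m → ≤-trans (*-monoˡ-≤ m i≤k/m) (m/n*n≤m k m))

count-multiples : ∀ m q k .{{_ : NonZero m}} → k < q * m → ∑[ i < q ] ⟦ i * m ≤ k ⟧ ≡ suc (k / m)
count-multiples m q k k<qm = trans (∑-cong q (λ i _ → ⟦≤⟧-cong (*≤⇔≤/ i m k))) (count-≤ (k / m) q (m<n*o⇒m/o<n k<qm))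

-- (m + a') / a is the ceiling of m / a when a = a' + 1.
≤*⇔⌈/⌉≤ : ∀ m a′ x → (m ≤ suc a′ * x ⇔ (m + a′) / suc a′ ≤ x)
≤*⇔⌈/⌉≤ m a′ x = mk⇔ to from
  where
  a = suc a′
  c = (m + a′) / a
  from : c ≤ x → m ≤ a * x
  from c≤x = +-cancelʳ-≤ a′ m (a * x) (begin
    m + a′               ≡⟨ m≡m%n+[m/n]*n (m + a′) a ⟩
    (m + a′) % a + c * a ≤⟨ +-monoˡ-≤ (c * a) (s≤s⁻¹ (m%n<n (m + a′) a)) ⟩
    a′ + c * a           ≤⟨ +-monoʳ-≤ a′ (*-monoˡ-≤ a c≤x) ⟩
    a′ + x * a           ≡⟨ cong (a′ +_) (*-comm x a) ⟩
    a′ + a * x           ≡⟨ +-comm a′ (a * x) ⟩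
    a * x + a′           ∎)
    where open ≤-Reasoning
  to : m ≤ a * x → c ≤ x
  to m≤ax = *≤⇒≤ (begin-strict
    c * a     ≤⟨ m/n*n≤m (m + a′) a ⟩
    m + a′    <⟨ +-monoʳ-< m ≤-refl ⟩
    m + a     ≤⟨ +-monoˡ-≤ a m≤ax ⟩
    a * x + a ≡⟨ +-comm (a * x) a ⟩
    a + a * x ≡⟨ cong (a +_) (*-comm a x) ⟩
    suc x * a ∎)
    where
    open ≤-Reasoning
    *≤⇒≤ : c * a < suc x * a → c ≤ x
    *≤⇒≤ lt = s≤s⁻¹ (*-cancelʳ-< a c (suc x) lt)

S₁ S₂ : ℕ → ℕ
S₁ n = ∑[ x < n ] x
S₂ n = ∑[ x < n ] (x * x)

S₁-closed : ∀ m → 2 * S₁ (suc m) ≡ m * suc m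
S₁-closed zero    = refl
S₁-closed (suc m) = begin
  2 * (S₁ (suc m) + suc m)   ≡⟨ *-distribˡ-+ 2 (S₁ (suc m)) (suc m) ⟩
  2 * S₁ (suc m) + 2 * suc m ≡⟨ cong (_+ 2 * suc m) (S₁-closed m) ⟩
  m * suc m + 2 * suc m      ≡⟨ step m ⟩
  suc m * suc (suc m)        ∎
  where
  open ≡-Reasoning
  step : ∀ m → m * suc m + 2 * suc m ≡ suc m * suc (suc m)
  step = solve-∀

S₁-closed′ : ∀ m → 2 * S₁ m + m ≡ m * m
S₁-closed′ zero    = refl
S₁-closed′ (suc m) = begin
  2 * S₁ (suc m) + suc m ≡⟨ cong (_+ suc m) (S₁-closed m) ⟩
  m * suc m + suc m      ≡⟨ +-comm (m * suc m) (suc m) ⟩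
  suc m * suc m          ∎
  where open ≡-Reasoning

S₂-closed : ∀ m → 6 * S₂ (suc m) ≡ m * suc m * (2 * m + 1)
S₂-closed zero    = refl
S₂-closed (suc m) = begin
  6 * (S₂ (suc m) + suc m * suc m)              ≡⟨ *-distribˡ-+ 6 (S₂ (suc m)) _ ⟩
  6 * S₂ (suc m) + 6 * (suc m * suc m)          ≡⟨ cong (_+ 6 * (suc m * suc m)) (S₂-closed m) ⟩
  m * suc m * (2 * m + 1) + 6 * (suc m * suc m) ≡⟨ step m ⟩
  suc m * suc (suc m) * (2 * suc m + 1)         ∎
  where
  open ≡-Reasoning
  step : ∀ m → m * suc m * (2 * m + 1) + 6 * (suc m * suc m) ≡ suc m * suc (suc m) * (2 * suc m + 1)
  step = solve-∀

S₂-closed′ : ∀ m → 6 * S₂ m + 3 * (m * m) ≡ 2 * (m * m * m) + m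
S₂-closed′ zero    = refl
S₂-closed′ (suc m) = begin
  6 * S₂ (suc m) + 3 * (suc m * suc m)          ≡⟨ cong (_+ 3 * (suc m * suc m)) (S₂-closed m) ⟩
  m * suc m * (2 * m + 1) + 3 * (suc m * suc m) ≡⟨ cube m ⟩
  2 * (suc m * suc m * suc m) + suc m           ∎
  where
  open ≡-Reasoning
  cube : ∀ m → m * suc m * (2 * m + 1) + 3 * (suc m * suc m) ≡ 2 * (suc m * suc m * suc m) + suc m
  cube = solve-∀

-- Equality up to an error

infix 4 _≈[_]_

record _≈[_]_ (x e y : ℕ) : Set where
  constructor _,_
  field
    upper : x ≤ y + e
    lower : y ≤ x + e

≈-resp : ∀ {x x′ e e′ y y′} → x ≡ x′ → e ≡ e′ → y ≡ y′ → x ≈[ e ] y → x′ ≈[ e′ ] y′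
≈-resp refl refl refl x≈y = x≈y

≈-refl : ∀ {e} x → x ≈[ e ] x
≈-refl {e} x = m≤m+n x e , m≤m+n x e

≈-sym : ∀ {e x y} → x ≈[ e ] y → y ≈[ e ] x
≈-sym (x≤ , y≤) = y≤ , x≤

≈-mono : ∀ {e f x y} → e ≤ f → x ≈[ e ] y → x ≈[ f ] y
≈-mono e≤f (x≤ , y≤) = ≤-trans x≤ (+-monoʳ-≤ _ e≤f) , ≤-trans y≤ (+-monoʳ-≤ _ e≤f)

≈-trans : ∀ {e f x y z} → x ≈[ e ] y → y ≈[ f ] z → x ≈[ e + f ] z
≈-trans {e} {f} {x} {z = z} (x≤ , y≤) (y≤′ , z≤) =
  ≤-trans x≤ (≤-trans (+-monoˡ-≤ e y≤′) (≤-reflexive (shuffle z f e))) ,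
  ≤-trans z≤ (≤-trans (+-monoˡ-≤ f y≤) (≤-reflexive (+-assoc x e f)))
  where
  shuffle : ∀ z f e → z + f + e ≡ z + (e + f)
  shuffle = solve-∀

≈-+ : ∀ {e f x y x′ y′} → x ≈[ e ] y → x′ ≈[ f ] y′ → x + x′ ≈[ e + f ] y + y′
≈-+ {e} {f} {x} {y} {x′} {y′} (x≤ , y≤) (x′≤ , y′≤) =
  ≤-trans (+-mono-≤ x≤ x′≤) (≤-reflexive (interchange y e y′ f)) ,
  ≤-trans (+-mono-≤ y≤ y′≤) (≤-reflexive (interchange x e x′ f))

≈-* : ∀ k {e x y} → x ≈[ e ] y → k * x ≈[ k * e ] k * y
≈-* k {e} {x} {y} (x≤ , y≤) =
  ≤-trans (*-monoʳ-≤ k x≤) (≤-reflexive (*-distribˡ-+ k y e)) ,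
  ≤-trans (*-monoʳ-≤ k y≤) (≤-reflexive (*-distribˡ-+ k x e))

≈-cancelʳ-+ : ∀ z {e x y} → x + z ≈[ e ] y + z → x ≈[ e ] y
≈-cancelʳ-+ z {e} {x} {y} (x≤ , y≤) =
  +-cancelʳ-≤ z x (y + e) (≤-trans x≤ (≤-reflexive (+-comm-middle y z e))) ,
  +-cancelʳ-≤ z y (x + e) (≤-trans y≤ (≤-reflexive (+-comm-middle x z e)))
  where
  +-comm-middle : ∀ y z e → y + z + e ≡ y + e + z
  +-comm-middle = solve-∀

≈-cancelˡ-* : ∀ k .{{_ : NonZero k}} {e x y} → k * x ≈[ k * e ] k * y → x ≈[ e ] y
≈-cancelˡ-* k {e} {x} {y} (x≤ , y≤) =
  *-cancelˡ-≤ k (≤-trans x≤ (≤-reflexive (sym (*-distribˡ-+ k y e)))) ,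
  *-cancelˡ-≤ k (≤-trans y≤ (≤-reflexive (sym (*-distribˡ-+ k x e))))

≈-⊔ : ∀ {e x y x′ y′} → x ≈[ e ] x′ → y ≈[ e ] y′ → x ⊔ y ≈[ e ] x′ ⊔ y′
≈-⊔ {e} {x} {y} {x′} {y′} (x≤ , x′≤) (y≤ , y′≤) =
  ≤-trans (⊔-mono-≤ x≤ y≤) (≤-reflexive (sym (+-distribʳ-⊔ e x′ y′))) ,
  ≤-trans (⊔-mono-≤ x′≤ y′≤) (≤-reflexive (sym (+-distribʳ-⊔ e x y)))

≈-∑ : ∀ n {e} {f g : ℕ → ℕ} → (∀ x → x < n → f x ≈[ e ] g x) → ∑ n f ≈[ n * e ] ∑ n g
≈-∑ zero    f≈g = ≈-refl 0
≈-∑ (suc n) {e} f≈g =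
  ≈-resp refl (+-comm (n * e) e) refl (≈-+ (≈-∑ n (λ x x<n → f≈g x (m<n⇒m<1+n x<n))) (f≈g n ≤-refl))

-- The lattice sum of max(i b, j a)

[t*n+r]%n≡r : ∀ t n r .{{_ : NonZero n}} → r < n → (t * n + r) % n ≡ r
[t*n+r]%n≡r t n r r<n = trans (cong (_% n) (+-comm (t * n) r)) (trans ([m+kn]%n≡m%n r t n) (m<n⇒m%n≡m r<n))

∑-linear*mod : ∀ c m a .{{_ : NonZero a}} →
  ∑[ k < m * a ] ((c + k) * (k % a)) ≡ c * m * S₁ a + a * S₁ m * S₁ a + m * S₂ a
∑-linear*mod c m a = begin
  ∑[ k < m * a ] ((c + k) * (k % a))
    ≡⟨ ∑-blocks m a _ ⟩
  ∑[ t < m ] ∑[ r < a ] ((c + (t * a + r)) * ((t * a + r) % a))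
    ≡⟨ ∑-cong m (λ t _ → ∑-cong a (λ r r<a → cong ((c + (t * a + r)) *_) ([t*n+r]%n≡r t a r r<a))) ⟩
  ∑[ t < m ] ∑[ r < a ] ((c + (t * a + r)) * r)
    ≡⟨ ∑-cong m (λ t _ → trans (∑-cong a (λ r _ → split-r c t a r)) (∑-distrib-+ a _ _)) ⟩
  ∑[ t < m ] (∑[ r < a ] ((c + t * a) * r) + S₂ a)
    ≡⟨ ∑-cong m (λ t _ → cong (_+ S₂ a) (∑-distribˡ a (c + t * a) (λ r → r))) ⟩
  ∑[ t < m ] ((c + t * a) * S₁ a + S₂ a)
    ≡⟨ ∑-cong m (λ t _ → split-t c t a (S₁ a) (S₂ a)) ⟩
  ∑[ t < m ] ((c * S₁ a + S₂ a) + t * (a * S₁ a))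
    ≡⟨ ∑-distrib-+ m _ _ ⟩
  ∑[ _ < m ] (c * S₁ a + S₂ a) + ∑[ t < m ] (t * (a * S₁ a))
    ≡⟨ cong₂ _+_ (∑-const m _) (∑-distribʳ m (a * S₁ a) (λ t → t)) ⟩
  m * (c * S₁ a + S₂ a) + S₁ m * (a * S₁ a)
    ≡⟨ collect c m a (S₁ a) (S₁ m) (S₂ a) ⟩
  c * m * S₁ a + a * S₁ m * S₁ a + m * S₂ a ∎
  where
  open ≡-Reasoning
  split-r : ∀ c t a r → (c + (t * a + r)) * r ≡ (c + t * a) * r + r * r
  split-r = solve-∀
  split-t : ∀ c t a s₁ s₂ → (c + t * a) * s₁ + s₂ ≡ (c * s₁ + s₂) + t * (a * s₁)
  split-t = solve-∀
  collect : ∀ c m a s₁ s₁′ s₂ → m * (c * s₁ + s₂) + s₁′ * (a * s₁) ≡ c * m * s₁ + a * s₁′ * s₁ + m * s₂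
  collect = solve-∀

-- Chinese remainder theorem: for each s < b, t ↦ (s + b t) mod a permutes [0, a).
∑-mod*mod : ∀ a b .{{_ : NonZero a}} .{{_ : NonZero b}} → Coprime a b →
  ∑[ k < a * b ] ((k % b) * (k % a)) ≡ S₁ b * S₁ a
∑-mod*mod a b a⊥b = begin
  ∑[ k < a * b ] ((k % b) * (k % a))
    ≡⟨ ∑-blocks a b _ ⟩
  ∑[ t < a ] ∑[ s < b ] (((t * b + s) % b) * ((t * b + s) % a))
    ≡⟨ ∑-cong a (λ t _ → ∑-cong b (λ s s<b → cong₂ _*_ ([t*n+r]%n≡r t b s s<b)
                                                        (cong (_% a) (trans (+-comm (t * b) s) (cong (s +_) (*-comm t b)))))) ⟩
  ∑[ t < a ] ∑[ s < b ] (s * ((s + b * t) % a))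
    ≡⟨ ∑-comm a b _ ⟩
  ∑[ s < b ] ∑[ t < a ] (s * ((s + b * t) % a))
    ≡⟨ ∑-cong b (λ s _ → trans (∑-distribˡ a s _) (cong (s *_) (∑-permute-affine a b s (λ r → r) a⊥b))) ⟩
  ∑[ s < b ] (s * S₁ a)
    ≡⟨ ∑-distribʳ b (S₁ a) (λ s → s) ⟩
  S₁ b * S₁ a ∎
  where open ≡-Reasoning

module LatticeSum (a′ b′ : ℕ) where

  private
    a b N : ℕ
    a = suc a′
    b = suc b′
    N = a * b

  maxSum : ℕ
  maxSum = ∑[ i < a ] ∑[ j < b ] (i * b ⊔ j * a)

  maxSum⁺ : ℕ
  maxSum⁺ = ∑[ i < a′ ] ∑[ j < b′ ] (suc i * b ⊔ suc j * a)

  maxSum-split : maxSum ≡ maxSum⁺ + a * S₁ b + b * S₁ a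
  maxSum-split = begin
    maxSum
      ≡⟨ ∑-suc a′ _ ⟩
    ∑[ j < b ] (0 ⊔ j * a) + ∑[ i < a′ ] ∑[ j < b ] (suc i * b ⊔ j * a)
      ≡⟨ cong₂ _+_ (∑-distribʳ b a (λ j → j))
                   (∑-cong a′ (λ i _ → trans (∑-suc b′ _)
                                             (cong (_+ ∑[ j < b′ ] (suc i * b ⊔ suc j * a)) (⊔-identityʳ (suc i * b))))) ⟩
    S₁ b * a + ∑[ i < a′ ] (suc i * b + ∑[ j < b′ ] (suc i * b ⊔ suc j * a))
      ≡⟨ cong (S₁ b * a +_) (∑-distrib-+ a′ _ _) ⟩
    S₁ b * a + (∑[ i < a′ ] (suc i * b) + maxSum⁺)
      ≡⟨ cong (λ s → S₁ b * a + (s + maxSum⁺)) (trans (sym (∑-suc a′ (λ i → i * b))) (∑-distribʳ a b (λ i → i))) ⟩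
    S₁ b * a + (S₁ a * b + maxSum⁺)
      ≡⟨ rearrange (S₁ b) a (S₁ a) b maxSum⁺ ⟩
    maxSum⁺ + a * S₁ b + b * S₁ a ∎
    where
    open ≡-Reasoning
    rearrange : ∀ s a s′ b m → s * a + (s′ * b + m) ≡ m + a * s + b * s′
    rearrange = solve-∀

  -- Q counts the pairs (i, j) with i b ≤ k and j a ≤ k, summed over k < ab.
  Q : ℕ
  Q = ∑[ k < N ] (suc (k / b) * suc (k / a))

  -- Each k < ab either lies below i b ⊔ j a or is counted in Q for the pair (i, j).
  maxSum+Q : maxSum + Q ≡ N * N
  maxSum+Q = begin
    maxSum + Q
      ≡⟨ cong (maxSum +_) Q-as-count ⟩
    ∑[ i < a ] ∑[ j < b ] v i j + ∑[ i < a ] ∑[ j < b ] ∑[ k < N ] ⟦ v i j ≤ k ⟧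
      ≡⟨ sym (∑-distrib-+ a _ _) ⟩
    ∑[ i < a ] (∑[ j < b ] v i j + ∑[ j < b ] ∑[ k < N ] ⟦ v i j ≤ k ⟧)
      ≡⟨ ∑-cong a (λ i i<a → trans (sym (∑-distrib-+ b _ _))
                              (∑-cong b (λ j j<b → trans (+-comm (v i j) _) (count-≥ (v i j) N (v≤N i j i<a j<b))))) ⟩
    ∑[ i < a ] ∑[ j < b ] N
      ≡⟨ trans (∑-cong a (λ i _ → ∑-const b N)) (∑-const a (b * N)) ⟩
    a * (b * N)
      ≡⟨ sym (*-assoc a b N) ⟩
    N * N ∎
    where
    open ≡-Reasoning
    v : ℕ → ℕ → ℕ
    v i j = i * b ⊔ j * a
    v≤N : ∀ i j → i < a → j < b → v i j ≤ N
    v≤N i j i<a j<b = ⊔-lub (*-monoˡ-≤ b (<⇒≤ i<a)) (≤-trans (*-monoˡ-≤ a (<⇒≤ j<b)) (≤-reflexive (*-comm b a)))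
    Q-as-count : Q ≡ ∑[ i < a ] ∑[ j < b ] ∑[ k < N ] ⟦ v i j ≤ k ⟧
    Q-as-count = begin
      ∑[ k < N ] (suc (k / b) * suc (k / a))
        ≡⟨ ∑-cong N (λ k k<N → sym (cong₂ _*_ (count-multiples b a k k<N) (count-multiples a b k (subst (k <_) (*-comm a b) k<N)))) ⟩
      ∑[ k < N ] (∑[ i < a ] ⟦ i * b ≤ k ⟧ * ∑[ j < b ] ⟦ j * a ≤ k ⟧)
        ≡⟨ ∑-cong N (λ k _ → sym (∑-*-∑ a b _ _)) ⟩
      ∑[ k < N ] ∑[ i < a ] ∑[ j < b ] (⟦ i * b ≤ k ⟧ * ⟦ j * a ≤ k ⟧)
        ≡⟨ ∑-cong N (λ k _ → ∑-cong a (λ i _ → ∑-cong b (λ j _ → ⟦⊔≤⟧ (i * b) (j * a) k))) ⟩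
      ∑[ k < N ] ∑[ i < a ] ∑[ j < b ] ⟦ v i j ≤ k ⟧
        ≡⟨ ∑-comm N a _ ⟩
      ∑[ i < a ] ∑[ k < N ] ∑[ j < b ] ⟦ v i j ≤ k ⟧
        ≡⟨ ∑-cong a (λ i _ → ∑-comm N b _) ⟩
      ∑[ i < a ] ∑[ j < b ] ∑[ k < N ] ⟦ v i j ≤ k ⟧ ∎

  -- ab (⌊k/b⌋ + 1) (⌊k/a⌋ + 1) = (b + k - k mod b) (a + k - k mod a), with the subtractions moved across.
  quotient-identity : ∀ k → N * (suc (k / b) * suc (k / a)) + (b + k) * (k % a) + (a + k) * (k % b)
                              ≡ (b + k) * (a + k) + (k % b) * (k % a)
  quotient-identity k = begin
    N * (suc (k / b) * suc (k / a)) + (b + k) * (k % a) + (a + k) * (k % b)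
      ≡⟨ cong₂ (λ x y → N * (suc (k / b) * suc (k / a)) + (b + x) * (k % a) + (a + y) * (k % b)) k≡ᵇ k≡ᵃ ⟩
    N * (suc (k / b) * suc (k / a)) + (b + (k % b + k / b * b)) * (k % a) + (a + (k % a + k / a * a)) * (k % b)
      ≡⟨ expand a b (k / b) (k % b) (k / a) (k % a) ⟩
    (b + (k % b + k / b * b)) * (a + (k % a + k / a * a)) + (k % b) * (k % a)
      ≡⟨ cong₂ (λ x y → (b + x) * (a + y) + (k % b) * (k % a)) (sym k≡ᵇ) (sym k≡ᵃ) ⟩
    (b + k) * (a + k) + (k % b) * (k % a) ∎
    where
    open ≡-Reasoning
    k≡ᵇ = m≡m%n+[m/n]*n k b
    k≡ᵃ = m≡m%n+[m/n]*n k a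
    expand : ∀ a b q r q′ r′ → a * b * (suc q * suc q′) + (b + (r + q * b)) * r′ + (a + (r′ + q′ * a)) * r
                               ≡ (b + (r + q * b)) * (a + (r′ + q′ * a)) + r * r′
    expand = solve-∀

  ∑-quotient-identity : N * Q + ∑[ k < N ] ((b + k) * (k % a)) + ∑[ k < N ] ((a + k) * (k % b))
                        ≡ ∑[ k < N ] ((b + k) * (a + k)) + ∑[ k < N ] ((k % b) * (k % a))
  ∑-quotient-identity = begin
    N * Q + ∑[ k < N ] ((b + k) * (k % a)) + ∑[ k < N ] ((a + k) * (k % b))
      ≡⟨ cong (λ s → s + ∑[ k < N ] ((b + k) * (k % a)) + ∑[ k < N ] ((a + k) * (k % b))) (sym (∑-distribˡ N N _)) ⟩
    ∑[ k < N ] (N * (suc (k / b) * suc (k / a))) + ∑[ k < N ] ((b + k) * (k % a)) + ∑[ k < N ] ((a + k) * (k % b))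
      ≡⟨ cong (_+ ∑[ k < N ] ((a + k) * (k % b))) (sym (∑-distrib-+ N _ _)) ⟩
    ∑[ k < N ] (N * (suc (k / b) * suc (k / a)) + (b + k) * (k % a)) + ∑[ k < N ] ((a + k) * (k % b))
      ≡⟨ sym (∑-distrib-+ N _ _) ⟩
    ∑[ k < N ] (N * (suc (k / b) * suc (k / a)) + (b + k) * (k % a) + (a + k) * (k % b))
      ≡⟨ ∑-cong N (λ k _ → quotient-identity k) ⟩
    ∑[ k < N ] ((b + k) * (a + k) + (k % b) * (k % a))
      ≡⟨ ∑-distrib-+ N _ _ ⟩
    ∑[ k < N ] ((b + k) * (a + k)) + ∑[ k < N ] ((k % b) * (k % a)) ∎
    where open ≡-Reasoning

  ∑-shifted-square : ∑[ k < N ] ((b + k) * (a + k)) ≡ N * (b * a) + (b + a) * S₁ N + S₂ N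
  ∑-shifted-square = begin
    ∑[ k < N ] ((b + k) * (a + k))
      ≡⟨ ∑-cong N (λ k _ → expand b a k) ⟩
    ∑[ k < N ] (b * a + k * (b + a) + k * k)
      ≡⟨ trans (∑-distrib-+ N _ _) (cong (_+ S₂ N) (∑-distrib-+ N _ _)) ⟩
    ∑[ _ < N ] (b * a) + ∑[ k < N ] (k * (b + a)) + S₂ N
      ≡⟨ cong₂ (λ x y → x + y + S₂ N) (∑-const N (b * a)) (trans (∑-distribʳ N (b + a) (λ k → k)) (*-comm (S₁ N) (b + a))) ⟩
    N * (b * a) + (b + a) * S₁ N + S₂ N ∎
    where
    open ≡-Reasoning
    expand : ∀ b a k → (b + k) * (a + k) ≡ b * a + k * (b + a) + k * k
    expand = solve-∀

  maxSum⁺-closed : Coprime a b → 12 * maxSum⁺ ≡ a′ * b′ * (8 * a′ * b′ + 7 * a′ + 7 * b′ + 5)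
  maxSum⁺-closed a⊥b = *-cancelˡ-≡ _ _ N (+-cancelʳ-≡ p₁ _ _ (begin
    N * (12 * maxSum⁺) + p₁                                  ≡⟨ cong (N * (12 * maxSum⁺) +_) E₁≡p₁ ⟨
    N * (12 * maxSum⁺) + E₁                                  ≡⟨ balance ⟩
    E₂                                                       ≡⟨ E₂≡p₂ ⟩
    p₂                                                       ≡⟨ solve-p a′ b′ ⟩
    N * (a′ * b′ * (8 * a′ * b′ + 7 * a′ + 7 * b′ + 5)) + p₁ ∎))
    where
    open ≡-Reasoning
    N′ = b′ + a′ * b
    T₃ T₄ T₅ R : ℕ
    T₃ = ∑[ k < N ] ((b + k) * (k % a))
    T₄ = ∑[ k < N ] ((a + k) * (k % b))
    T₅ = ∑[ k < N ] ((b + k) * (a + k))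
    R  = ∑[ k < N ] ((k % b) * (k % a))
    E₁ E₂ p₁ p₂ : ℕ
    E₁ = N * (12 * (a * S₁ b + b * S₁ a)) + 12 * (T₅ + R)
    E₂ = 12 * (N * (N * N)) + 12 * (T₃ + T₄)
    p₁ = N * (6 * a * (b′ * b) + 6 * b * (a′ * a)) + 12 * N * (b * a) + 6 * (b + a) * (N′ * N)
         + 2 * (N′ * N * (2 * N′ + 1)) + 3 * (b′ * b) * (a′ * a)
    p₂ = 12 * (N * (N * N)) + 6 * b * b * (a′ * a) + 3 * a * (b′ * b) * (a′ * a) + 2 * b * (a′ * a * (2 * a′ + 1))
         + 6 * a * a * (b′ * b) + 3 * b * (a′ * a) * (b′ * b) + 2 * a * (b′ * b * (2 * b′ + 1))
    balance : N * (12 * maxSum⁺) + E₁ ≡ E₂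
    balance = begin
      N * (12 * maxSum⁺) + (N * (12 * (a * S₁ b + b * S₁ a)) + 12 * (T₅ + R))
        ≡⟨ regroup N maxSum⁺ (a * S₁ b) (b * S₁ a) (T₅ + R) ⟩
      12 * (N * (maxSum⁺ + a * S₁ b + b * S₁ a)) + 12 * (T₅ + R)
        ≡⟨ cong₂ (λ x y → 12 * (N * x) + 12 * y) (sym maxSum-split) (sym ∑-quotient-identity) ⟩
      12 * (N * maxSum) + 12 * (N * Q + T₃ + T₄)
        ≡⟨ regroup′ N maxSum Q T₃ T₄ ⟩
      12 * (N * (maxSum + Q)) + 12 * (T₃ + T₄)
        ≡⟨ cong (λ x → 12 * (N * x) + 12 * (T₃ + T₄)) maxSum+Q ⟩
      E₂ ∎
      where
      regroup : ∀ N m s t u → N * (12 * m) + (N * (12 * (s + t)) + 12 * u) ≡ 12 * (N * (m + s + t)) + 12 * u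
      regroup = solve-∀
      regroup′ : ∀ N m q t t′ → 12 * (N * m) + 12 * (N * q + t + t′) ≡ 12 * (N * (m + q)) + 12 * (t + t′)
      regroup′ = solve-∀
    E₁≡p₁ : E₁ ≡ p₁
    E₁≡p₁ = begin
      E₁
        ≡⟨ cong₂ (λ x y → N * (12 * (a * S₁ b + b * S₁ a)) + 12 * (x + y)) ∑-shifted-square (∑-mod*mod a b a⊥b) ⟩
      N * (12 * (a * S₁ b + b * S₁ a)) + 12 * (N * (b * a) + (b + a) * S₁ N + S₂ N + S₁ b * S₁ a)
        ≡⟨ regroup N a b (S₁ a) (S₁ b) (S₁ N) (S₂ N) ⟩
      N * (6 * a * (2 * S₁ b) + 6 * b * (2 * S₁ a)) + 12 * N * (b * a) + 6 * (b + a) * (2 * S₁ N)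
        + 2 * (6 * S₂ N) + 3 * (2 * S₁ b) * (2 * S₁ a)
        ≡⟨ cong₂ (λ x y → N * (6 * a * x + 6 * b * y) + 12 * N * (b * a) + 6 * (b + a) * (2 * S₁ N)
                          + 2 * (6 * S₂ N) + 3 * x * y) (S₁-closed b′) (S₁-closed a′) ⟩
      N * (6 * a * (b′ * b) + 6 * b * (a′ * a)) + 12 * N * (b * a) + 6 * (b + a) * (2 * S₁ N)
        + 2 * (6 * S₂ N) + 3 * (b′ * b) * (a′ * a)
        ≡⟨ cong₂ (λ x y → N * (6 * a * (b′ * b) + 6 * b * (a′ * a)) + 12 * N * (b * a) + 6 * (b + a) * x
                          + 2 * y + 3 * (b′ * b) * (a′ * a)) (S₁-closed N′) (S₂-closed N′) ⟩
      p₁ ∎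
      where
      regroup : ∀ N a b s₁a s₁b s₁N s₂N →
        N * (12 * (a * s₁b + b * s₁a)) + 12 * (N * (b * a) + (b + a) * s₁N + s₂N + s₁b * s₁a)
        ≡ N * (6 * a * (2 * s₁b) + 6 * b * (2 * s₁a)) + 12 * N * (b * a) + 6 * (b + a) * (2 * s₁N)
          + 2 * (6 * s₂N) + 3 * (2 * s₁b) * (2 * s₁a)
      regroup = solve-∀
    E₂≡p₂ : E₂ ≡ p₂
    E₂≡p₂ = begin
      E₂
        ≡⟨ cong₂ (λ x y → 12 * (N * (N * N)) + 12 * (x + y))
                 (trans (cong (λ m → ∑[ k < m ] ((b + k) * (k % a))) (*-comm a b)) (∑-linear*mod b b a))
                 (∑-linear*mod a a b) ⟩
      12 * (N * (N * N)) + 12 * (b * b * S₁ a + a * S₁ b * S₁ a + b * S₂ a + (a * a * S₁ b + b * S₁ a * S₁ b + a * S₂ b))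
        ≡⟨ regroup N a b (S₁ a) (S₁ b) (S₂ a) (S₂ b) ⟩
      12 * (N * (N * N)) + 6 * b * b * (2 * S₁ a) + 3 * a * (2 * S₁ b) * (2 * S₁ a) + 2 * b * (6 * S₂ a)
        + 6 * a * a * (2 * S₁ b) + 3 * b * (2 * S₁ a) * (2 * S₁ b) + 2 * a * (6 * S₂ b)
        ≡⟨ cong₂ (λ x y → 12 * (N * (N * N)) + 6 * b * b * x + 3 * a * y * x + 2 * b * (6 * S₂ a)
                          + 6 * a * a * y + 3 * b * x * y + 2 * a * (6 * S₂ b)) (S₁-closed a′) (S₁-closed b′) ⟩
      12 * (N * (N * N)) + 6 * b * b * (a′ * a) + 3 * a * (b′ * b) * (a′ * a) + 2 * b * (6 * S₂ a)
        + 6 * a * a * (b′ * b) + 3 * b * (a′ * a) * (b′ * b) + 2 * a * (6 * S₂ b)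
        ≡⟨ cong₂ (λ x y → 12 * (N * (N * N)) + 6 * b * b * (a′ * a) + 3 * a * (b′ * b) * (a′ * a) + 2 * b * x
                          + 6 * a * a * (b′ * b) + 3 * b * (a′ * a) * (b′ * b) + 2 * a * y) (S₂-closed a′) (S₂-closed b′) ⟩
      p₂ ∎
      where
      regroup : ∀ N a b s₁a s₁b s₂a s₂b →
        12 * (N * (N * N)) + 12 * (b * b * s₁a + a * s₁b * s₁a + b * s₂a + (a * a * s₁b + b * s₁a * s₁b + a * s₂b))
        ≡ 12 * (N * (N * N)) + 6 * b * b * (2 * s₁a) + 3 * a * (2 * s₁b) * (2 * s₁a) + 2 * b * (6 * s₂a)
          + 6 * a * a * (2 * s₁b) + 3 * b * (2 * s₁a) * (2 * s₁b) + 2 * a * (6 * s₂b)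
      regroup = solve-∀
    solve-p : ∀ a′ b′ → let a = suc a′; b = suc b′; N = a * b; N′ = b′ + a′ * b in
      12 * (N * (N * N)) + 6 * b * b * (a′ * a) + 3 * a * (b′ * b) * (a′ * a) + 2 * b * (a′ * a * (2 * a′ + 1))
        + 6 * a * a * (b′ * b) + 3 * b * (a′ * a) * (b′ * b) + 2 * a * (b′ * b * (2 * b′ + 1))
      ≡ N * (a′ * b′ * (8 * a′ * b′ + 7 * a′ + 7 * b′ + 5))
        + (N * (6 * a * (b′ * b) + 6 * b * (a′ * a)) + 12 * N * (b * a) + 6 * (b + a) * (N′ * N)
           + 2 * (N′ * N * (2 * N′ + 1)) + 3 * (b′ * b) * (a′ * a))
    solve-p = solve-∀

open LatticeSum using (maxSum⁺; maxSum⁺-closed)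

-- Floor sums

-- Rests on the identity 2 a² S₁ c = (a c)² - a (a c).
2a²S₁c≈m² : ∀ a′ n c m .{{_ : NonZero n}} → let a = suc a′ in m ≤ a * c → a * c ≤ m + a′ → m ≤ a * n →
            2 * (a * a) * S₁ c ≈[ 2 * (a * a) * n ] m * m
2a²S₁c≈m² a′ n c m m≤ac ac≤m+a′ m≤an = upper , lower
  where
  a = suc a′
  ac = a * c
  S = 2 * (a * a) * S₁ c
  S+a·ac : S + a * ac ≡ ac * ac
  S+a·ac = trans (regroup a (S₁ c) c) (trans (cong (a * a *_) (S₁-closed′ c)) (square a c))
    where
    regroup : ∀ a s c → 2 * (a * a) * s + a * (a * c) ≡ a * a * (2 * s + c)
    regroup = solve-∀
    square : ∀ a c → a * a * (c * c) ≡ a * c * (a * c)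
    square = solve-∀
  double : ∀ a n → a * (a * n + a * n) ≡ 2 * (a * a) * n
  double = solve-∀
  upper : S ≤ m * m + 2 * (a * a) * n
  upper = begin
    S                   ≤⟨ +-cancelʳ-≤ (a * ac) S (m * ac) (begin
                             S + a * ac       ≡⟨ S+a·ac ⟩
                             ac * ac          ≤⟨ *-monoˡ-≤ ac ac≤m+a′ ⟩
                             (m + a′) * ac    ≡⟨ *-distribʳ-+ ac m a′ ⟩
                             m * ac + a′ * ac ≤⟨ +-monoʳ-≤ (m * ac) (*-monoˡ-≤ ac (n≤1+n a′)) ⟩
                             m * ac + a * ac  ∎) ⟩
    m * ac                              ≤⟨ *-monoʳ-≤ m ac≤m+a′ ⟩
    m * (m + a′)                        ≡⟨ *-distribˡ-+ m m a′ ⟩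
    m * m + m * a′                      ≤⟨ +-monoʳ-≤ (m * m) (*-mono-≤ m≤an (n≤1+n a′)) ⟩
    m * m + a * n * a                   ≤⟨ +-monoʳ-≤ (m * m) (≤-trans (≤-reflexive (*-comm (a * n) a)) (m≤m+n (a * (a * n)) _)) ⟩
    m * m + (a * (a * n) + a * (a * n)) ≡⟨ cong (m * m +_) (trans (sym (*-distribˡ-+ a (a * n) (a * n))) (double a n)) ⟩
    m * m + 2 * (a * a) * n             ∎
    where open ≤-Reasoning
  lower : m * m ≤ S + 2 * (a * a) * n
  lower = begin
    m * m                   ≤⟨ *-mono-≤ m≤ac m≤ac ⟩
    ac * ac                 ≡⟨ S+a·ac ⟨
    S + a * ac              ≤⟨ +-monoʳ-≤ S (*-monoʳ-≤ a ac≤m+a′) ⟩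
    S + a * (m + a′)        ≤⟨ +-monoʳ-≤ S (*-monoʳ-≤ a (+-mono-≤ m≤an (≤-trans (n≤1+n a′) (m≤m*n a n)))) ⟩
    S + a * (a * n + a * n) ≡⟨ cong (S +_) (double a n) ⟩
    S + 2 * (a * a) * n     ∎
    where open ≤-Reasoning

module Floor (a′ n′ : ℕ) where

  a n : ℕ
  a = suc a′
  n = suc n′

  q r : ℕ → ℕ
  q x = (a * x) / n
  r x = (a * x) % n

  -- c i = ⌈(i + 1) n / a⌉ is the least x with (i + 1) n ≤ a x, so q x counts the i < a - 1 with c i ≤ x.
  c : ℕ → ℕ
  c i = (suc i * n + a′) / a

  c-lower : ∀ i → suc i * n ≤ a * c i
  c-lower i = Equivalence.from (≤*⇔⌈/⌉≤ (suc i * n) a′ (c i)) ≤-refl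

  c-upper : ∀ i → a * c i ≤ suc i * n + a′
  c-upper i = ≤-trans (≤-reflexive (*-comm a (c i))) (m/n*n≤m (suc i * n + a′) a)

  [i+1]n≤an : ∀ {i} → i < a′ → suc i * n ≤ a * n
  [i+1]n≤an i<a′ = *-monoˡ-≤ n (m≤n⇒m≤1+n i<a′)

  c≤n : ∀ i → i < a′ → c i ≤ n
  c≤n i i<a′ = Equivalence.to (≤*⇔⌈/⌉≤ (suc i * n) a′ n) ([i+1]n≤an i<a′)

  q-as-count : ∀ x → x < n → q x ≡ ∑[ i < a′ ] ⟦ c i ≤ x ⟧
  q-as-count x x<n = suc-injective (begin
    suc (q x)                    ≡⟨ count-multiples n a (a * x) (*-monoʳ-< a x<n) ⟨
    ∑[ i < a ] ⟦ i * n ≤ a * x ⟧ ≡⟨ ∑-suc a′ _ ⟩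
    1 + ∑[ i < a′ ] ⟦ suc i * n ≤ a * x ⟧
      ≡⟨ cong suc (∑-cong a′ (λ i _ → ⟦≤⟧-cong (≤*⇔⌈/⌉≤ (suc i * n) a′ x))) ⟩
    suc (∑[ i < a′ ] ⟦ c i ≤ x ⟧)          ∎)
    where open ≡-Reasoning

  X C : ℕ
  X = ∑[ x < n ] (x * q x)
  C = ∑[ i < a′ ] S₁ (c i)

  X+C : X + C ≡ a′ * S₁ n
  X+C = begin
    X + C
      ≡⟨ cong (_+ C) (∑-cong n (λ x x<n → cong (x *_) (q-as-count x x<n))) ⟩
    ∑[ x < n ] (x * ∑[ i < a′ ] ⟦ c i ≤ x ⟧) + C
      ≡⟨ cong (_+ C) (∑-cong n (λ x _ → trans (sym (∑-distribˡ a′ x _)) (∑-cong a′ (λ i _ → *-comm x _)))) ⟩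
    ∑[ x < n ] ∑[ i < a′ ] (⟦ c i ≤ x ⟧ * x) + C
      ≡⟨ cong (_+ C) (∑-comm n a′ _) ⟩
    ∑[ i < a′ ] ∑[ x < n ] (⟦ c i ≤ x ⟧ * x) + C
      ≡⟨ sym (∑-distrib-+ a′ _ _) ⟩
    ∑[ i < a′ ] (∑[ x < n ] (⟦ c i ≤ x ⟧ * x) + S₁ (c i))
      ≡⟨ ∑-cong a′ (λ i i<a′ → ∑-restrict (c i) n (λ x → x) (c≤n i i<a′)) ⟩
    ∑[ _ < a′ ] S₁ n
      ≡⟨ ∑-const a′ (S₁ n) ⟩
    a′ * S₁ n ∎
    where open ≡-Reasoning

  2a²C≈n²S₂a : 2 * (a * a) * C ≈[ a′ * (2 * (a * a) * n) ] n * n * S₂ a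
  2a²C≈n²S₂a = ≈-resp (∑-distribˡ a′ (2 * (a * a)) (λ i → S₁ (c i))) refl
    (trans (∑-cong a′ (λ i _ → regroup i n))
           (trans (∑-distribˡ a′ (n * n) (λ i → suc i * suc i)) (cong (n * n *_) (sym (∑-suc a′ (λ i → i * i))))))
    (≈-∑ a′ (λ i i<a′ → 2a²S₁c≈m² a′ n (c i) (suc i * n) (c-lower i) (c-upper i) ([i+1]n≤an i<a′)))
    where
    regroup : ∀ i n → suc i * n * (suc i * n) ≡ n * n * (suc i * suc i)
    regroup = solve-∀

scaled-≈ : ∀ {k′ c m} l → m ≤ suc k′ * c → suc k′ * c ≤ m + k′ → l * (suc k′ * c) ≈[ l * suc k′ ] l * m
scaled-≈ {k′} {m = m} l lower upper =
  ≤-trans (*-monoʳ-≤ l upper) (≤-trans (≤-reflexive (*-distribˡ-+ l m k′)) (+-monoʳ-≤ (l * m) (*-monoʳ-≤ l (n≤1+n k′)))) ,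
  ≤-trans (*-monoʳ-≤ l lower) (m≤m+n _ _)

module FloorPair (a′ b′ n′ : ℕ) where

  module A = Floor a′ n′
  module B = Floor b′ n′
  open A public using (a; n)
  open B public using () renaming (a to b)

  T P D : ℕ
  T = ∑[ x < n ] (A.r x * B.r x)
  P = ∑[ x < n ] (A.q x * B.q x)
  D = ∑[ i < a′ ] ∑[ j < b′ ] (A.c i ⊔ B.c j)

  floor-expansion : T + n * (a * B.X + b * A.X) ≡ a * b * S₂ n + n * n * P
  floor-expansion = begin
    T + n * (a * B.X + b * A.X)
      ≡⟨ cong (λ s → T + n * s) (cong₂ _+_ (sym (∑-distribˡ n a _)) (sym (∑-distribˡ n b _))) ⟩
    T + n * (∑[ x < n ] (a * (x * B.q x)) + ∑[ x < n ] (b * (x * A.q x)))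
      ≡⟨ cong (λ s → T + n * s) (sym (∑-distrib-+ n _ _)) ⟩
    T + n * ∑[ x < n ] (a * (x * B.q x) + b * (x * A.q x))
      ≡⟨ cong (T +_) (sym (∑-distribˡ n n _)) ⟩
    T + ∑[ x < n ] (n * (a * (x * B.q x) + b * (x * A.q x)))
      ≡⟨ sym (∑-distrib-+ n _ _) ⟩
    ∑[ x < n ] (A.r x * B.r x + n * (a * (x * B.q x) + b * (x * A.q x)))
      ≡⟨ ∑-cong n (λ x _ → pointwise x) ⟩
    ∑[ x < n ] (a * b * (x * x) + n * n * (A.q x * B.q x))
      ≡⟨ ∑-distrib-+ n _ _ ⟩
    ∑[ x < n ] (a * b * (x * x)) + ∑[ x < n ] (n * n * (A.q x * B.q x))
      ≡⟨ cong₂ _+_ (∑-distribˡ n (a * b) _) (∑-distribˡ n (n * n) _) ⟩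
    a * b * S₂ n + n * n * P ∎
    where
    open ≡-Reasoning
    pointwise : ∀ x → A.r x * B.r x + n * (a * (x * B.q x) + b * (x * A.q x)) ≡ a * b * (x * x) + n * n * (A.q x * B.q x)
    pointwise x = begin
      A.r x * B.r x + n * (a * (x * B.q x) + b * (x * A.q x))
        ≡⟨ cong₂ (λ u v → A.r x * B.r x + n * (u + v)) (swap a x (B.q x)) (swap b x (A.q x)) ⟩
      A.r x * B.r x + n * (B.q x * (a * x) + A.q x * (b * x))
        ≡⟨ cong₂ (λ u v → A.r x * B.r x + n * (B.q x * u + A.q x * v)) (m≡m%n+[m/n]*n (a * x) n) (m≡m%n+[m/n]*n (b * x) n) ⟩
      A.r x * B.r x + n * (B.q x * (A.r x + A.q x * n) + A.q x * (B.r x + B.q x * n))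
        ≡⟨ expand (A.r x) (B.r x) (A.q x) (B.q x) n ⟩
      (A.r x + A.q x * n) * (B.r x + B.q x * n) + n * n * (A.q x * B.q x)
        ≡⟨ cong₂ (λ u v → u * v + n * n * (A.q x * B.q x)) (m≡m%n+[m/n]*n (a * x) n) (m≡m%n+[m/n]*n (b * x) n) ⟨
      a * x * (b * x) + n * n * (A.q x * B.q x)
        ≡⟨ cong (_+ n * n * (A.q x * B.q x)) (square a b x) ⟩
      a * b * (x * x) + n * n * (A.q x * B.q x) ∎
      where
      expand : ∀ u v s t n → u * v + n * (t * (u + s * n) + s * (v + t * n)) ≡ (u + s * n) * (v + t * n) + n * n * (s * t)
      expand = solve-∀
      square : ∀ a b x → a * x * (b * x) ≡ a * b * (x * x)
      square = solve-∀
      swap : ∀ a x q → a * (x * q) ≡ q * (a * x)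
      swap = solve-∀

  P+D : P + D ≡ a′ * (b′ * n)
  P+D = begin
    P + D
      ≡⟨ cong (_+ D) P-as-count ⟩
    ∑[ i < a′ ] ∑[ j < b′ ] ∑[ x < n ] ⟦ A.c i ⊔ B.c j ≤ x ⟧ + D
      ≡⟨ sym (∑-distrib-+ a′ _ _) ⟩
    ∑[ i < a′ ] (∑[ j < b′ ] ∑[ x < n ] ⟦ A.c i ⊔ B.c j ≤ x ⟧ + ∑[ j < b′ ] (A.c i ⊔ B.c j))
      ≡⟨ ∑-cong a′ (λ i i<a′ → trans (sym (∑-distrib-+ b′ _ _))
                                  (∑-cong b′ (λ j j<b′ → count-≥ _ n (⊔-lub (A.c≤n i i<a′) (B.c≤n j j<b′))))) ⟩
    ∑[ i < a′ ] ∑[ j < b′ ] n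
      ≡⟨ trans (∑-cong a′ (λ i _ → ∑-const b′ n)) (∑-const a′ (b′ * n)) ⟩
    a′ * (b′ * n) ∎
    where
    open ≡-Reasoning
    P-as-count : P ≡ ∑[ i < a′ ] ∑[ j < b′ ] ∑[ x < n ] ⟦ A.c i ⊔ B.c j ≤ x ⟧
    P-as-count = begin
      P
        ≡⟨ ∑-cong n (λ x x<n → trans (cong₂ _*_ (A.q-as-count x x<n) (B.q-as-count x x<n)) (sym (∑-*-∑ a′ b′ _ _))) ⟩
      ∑[ x < n ] ∑[ i < a′ ] ∑[ j < b′ ] (⟦ A.c i ≤ x ⟧ * ⟦ B.c j ≤ x ⟧)
        ≡⟨ ∑-cong n (λ x _ → ∑-cong a′ (λ i _ → ∑-cong b′ (λ j _ → ⟦⊔≤⟧ (A.c i) (B.c j) x))) ⟩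
      ∑[ x < n ] ∑[ i < a′ ] ∑[ j < b′ ] ⟦ A.c i ⊔ B.c j ≤ x ⟧
        ≡⟨ ∑-comm n a′ _ ⟩
      ∑[ i < a′ ] ∑[ x < n ] ∑[ j < b′ ] ⟦ A.c i ⊔ B.c j ≤ x ⟧
        ≡⟨ ∑-cong a′ (λ i _ → ∑-comm n b′ _) ⟩
      ∑[ i < a′ ] ∑[ j < b′ ] ∑[ x < n ] ⟦ A.c i ⊔ B.c j ≤ x ⟧ ∎

  abD≈n·maxSum⁺ : a * b * D ≈[ a′ * (b′ * (a * b)) ] n * maxSum⁺ a′ b′
  abD≈n·maxSum⁺ = ≈-resp
    (trans (∑-cong a′ (λ i _ → ∑-distribˡ b′ (a * b) _)) (∑-distribˡ a′ (a * b) _)) refl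
    (trans (∑-cong a′ (λ i _ → ∑-distribˡ b′ n _)) (∑-distribˡ a′ n _))
    (≈-∑ a′ (λ i _ → ≈-∑ b′ (λ j _ → pointwise i j)))
    where
    pointwise : ∀ i j → a * b * (A.c i ⊔ B.c j) ≈[ a * b ] n * (suc i * b ⊔ suc j * a)
    pointwise i j = ≈-resp (sym (*-distribˡ-⊔ (a * b) (A.c i) (B.c j))) refl (sym (*-distribˡ-⊔ n (suc i * b) (suc j * a)))
      (≈-⊔ (≈-resp (sym (assoc a b (A.c i))) (*-comm b a) (shift n i b) (scaled-≈ b (A.c-lower i) (A.c-upper i)))
           (≈-resp (sym (*-assoc a b (B.c j))) refl (shift n j a) (scaled-≈ a (B.c-lower j) (B.c-upper j))))
      where
      assoc : ∀ a b c → a * b * c ≡ b * (a * c)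
      assoc = solve-∀
      shift : ∀ n i b → b * (suc i * n) ≡ n * (suc i * b)
      shift = solve-∀

-- The sums of u v and of max(u, v)

2S₁≈n² : ∀ n → 2 * S₁ n ≈[ n ] n * n
2S₁≈n² n = ≤-trans (m≤m+n (2 * S₁ n) n) (≤-trans (≤-reflexive (S₁-closed′ n)) (m≤m+n (n * n) n)) ,
           ≤-reflexive (sym (S₁-closed′ n))

6S₂≈2n³ : ∀ n → 6 * S₂ n ≈[ 3 * (n * n) ] 2 * (n * n * n)
6S₂≈2n³ n = ≤-trans (m≤m+n (6 * S₂ n) (3 * (n * n))) (≤-trans (≤-reflexive (S₂-closed′ n)) (+-monoʳ-≤ _ (n≤3n² n))) ,
            ≤-trans (m≤m+n (2 * (n * n * n)) n) (≤-reflexive (sym (S₂-closed′ n)))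
  where
  n≤3n² : ∀ n → n ≤ 3 * (n * n)
  n≤3n² zero    = z≤n
  n≤3n² (suc k) = ≤-trans (m≤m*n (suc k) (suc k)) (m≤m+n (suc k * suc k) _)

Cᵀ : ℕ → ℕ → ℕ
Cᵀ a′ b′ = 6 * (a * a) * (b * b) * (a * b′ + a′ * b) + 12 * (a * a) * (b * b) * (a′ * b′)
           + 6 * (a * a * a) * (b * b * b) + 12 * (a * a * a) * (b * b) * b′ + 12 * (a * a) * (b * b * b) * a′
  where
  a b : ℕ
  a = suc a′
  b = suc b′

Cᵐ : ℕ → ℕ → ℕ
Cᵐ a′ b′ = 2 * Cᵀ a′ b′ + 24 * (suc a′ * suc a′) * (suc b′ * suc b′)

module ResidueProducts (a′ b′ n′ : ℕ) where

  open FloorPair a′ b′ n′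

  T-identity : T + n * ((a * b′ + a′ * b) * S₁ n) + n * n * D
               ≡ a * b * S₂ n + n * n * (a′ * (b′ * n)) + n * (a * B.C + b * A.C)
  T-identity = begin
    T + n * ((a * b′ + a′ * b) * S₁ n) + n * n * D
      ≡⟨ cong (λ s → T + n * s + n * n * D) (distribute a b a′ b′ (S₁ n)) ⟩
    T + n * (a * (b′ * S₁ n) + b * (a′ * S₁ n)) + n * n * D
      ≡⟨ cong₂ (λ x y → T + n * (a * x + b * y) + n * n * D) B.X+C A.X+C ⟨
    T + n * (a * (B.X + B.C) + b * (A.X + A.C)) + n * n * D
      ≡⟨ regroup T n a b B.X B.C A.X A.C D ⟩
    (T + n * (a * B.X + b * A.X)) + n * n * D + n * (a * B.C + b * A.C)
      ≡⟨ cong (λ s → s + n * n * D + n * (a * B.C + b * A.C)) floor-expansion ⟩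
    a * b * S₂ n + n * n * P + n * n * D + n * (a * B.C + b * A.C)
      ≡⟨ cong (_+ n * (a * B.C + b * A.C)) (+-assoc (a * b * S₂ n) (n * n * P) (n * n * D)) ⟩
    a * b * S₂ n + (n * n * P + n * n * D) + n * (a * B.C + b * A.C)
      ≡⟨ cong (λ s → a * b * S₂ n + s + n * (a * B.C + b * A.C)) (trans (sym (*-distribˡ-+ (n * n) P D)) (cong (n * n *_) P+D)) ⟩
    a * b * S₂ n + n * n * (a′ * (b′ * n)) + n * (a * B.C + b * A.C) ∎
    where
    open ≡-Reasoning
    distribute : ∀ a b a′ b′ s → (a * b′ + a′ * b) * s ≡ a * (b′ * s) + b * (a′ * s)
    distribute = solve-∀
    regroup : ∀ T n a b x c x′ c′ d → T + n * (a * (x + c) + b * (x′ + c′)) + n * n * d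
                                      ≡ (T + n * (a * x + b * x′)) + n * n * d + n * (a * c + b * c′)
    regroup = solve-∀

  -- Scale T-identity by 12 a² b², replace each sum by its approximation (U by U′, V by V′); the closed
  -- forms of S₂ a, S₂ b and maxSum⁺ then make V′ exactly a b (3 a b + 1) n³ + U′.
  T≈ : Coprime a b → 12 * (a * a) * (b * b) * T ≈[ Cᵀ a′ b′ * (n * n) ] a * b * (3 * a * b + 1) * (n * n * n)
  T≈ a⊥b = ≈-resp refl errors refl (≈-cancelʳ-+ U′ (≈-resp refl refl V′-closed
    (≈-trans (≈-+ (≈-refl {0} (12 * (a * a) * (b * b) * T)) (≈-sym U≈U′))
             (≈-resp (sym balance) refl refl V≈V′))))
    where
    k : ℕ
    k = 6 * (a * a) * (b * b) * (a * b′ + a′ * b)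
    M = maxSum⁺ a′ b′
    U U′ V V′ eU eV : ℕ
    U  = k * n * (2 * S₁ n) + 12 * (a * b) * (n * n) * (a * b * D)
    U′ = k * n * (n * n) + 12 * (a * b) * (n * n) * (n * M)
    V  = 2 * (a * a * a) * (b * b * b) * (6 * S₂ n) + 12 * (a * a) * (b * b) * (a′ * (b′ * n)) * (n * n)
         + 6 * (a * a * a) * n * (2 * (b * b) * B.C) + 6 * (b * b * b) * n * (2 * (a * a) * A.C)
    V′ = 2 * (a * a * a) * (b * b * b) * (2 * (n * n * n)) + 12 * (a * a) * (b * b) * (a′ * (b′ * n)) * (n * n)
         + 6 * (a * a * a) * n * (n * n * S₂ b) + 6 * (b * b * b) * n * (n * n * S₂ a)
    eU = k * n * n + 12 * (a * b) * (n * n) * (a′ * (b′ * (a * b)))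
    eV = 2 * (a * a * a) * (b * b * b) * (3 * (n * n)) + 0
         + 6 * (a * a * a) * n * (b′ * (2 * (b * b) * n)) + 6 * (b * b * b) * n * (a′ * (2 * (a * a) * n))
    U≈U′ : U ≈[ eU ] U′
    U≈U′ = ≈-+ (≈-* (k * n) (2S₁≈n² n)) (≈-* (12 * (a * b) * (n * n)) abD≈n·maxSum⁺)
    V≈V′ : V ≈[ eV ] V′
    V≈V′ = ≈-+ (≈-+ (≈-+ (≈-* (2 * (a * a * a) * (b * b * b)) (6S₂≈2n³ n)) (≈-refl _))
                     (≈-* (6 * (a * a * a) * n) B.2a²C≈n²S₂a))
                (≈-* (6 * (b * b * b) * n) A.2a²C≈n²S₂a)
    balance : 12 * (a * a) * (b * b) * T + U ≡ V
    balance = begin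
      12 * (a * a) * (b * b) * T + U
        ≡⟨ lhs a b a′ b′ n T (S₁ n) D ⟩
      12 * (a * a) * (b * b) * (T + n * ((a * b′ + a′ * b) * S₁ n) + n * n * D)
        ≡⟨ cong (12 * (a * a) * (b * b) *_) T-identity ⟩
      12 * (a * a) * (b * b) * (a * b * S₂ n + n * n * (a′ * (b′ * n)) + n * (a * B.C + b * A.C))
        ≡⟨ rhs a b a′ b′ n (S₂ n) B.C A.C ⟩
      V ∎
      where
      open ≡-Reasoning
      lhs : ∀ a b a′ b′ n T s d →
        12 * (a * a) * (b * b) * T + (6 * (a * a) * (b * b) * (a * b′ + a′ * b) * n * (2 * s) + 12 * (a * b) * (n * n) * (a * b * d))
        ≡ 12 * (a * a) * (b * b) * (T + n * ((a * b′ + a′ * b) * s) + n * n * d)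
      lhs = solve-∀
      rhs : ∀ a b a′ b′ n s cb ca →
        12 * (a * a) * (b * b) * (a * b * s + n * n * (a′ * (b′ * n)) + n * (a * cb + b * ca))
        ≡ 2 * (a * a * a) * (b * b * b) * (6 * s) + 12 * (a * a) * (b * b) * (a′ * (b′ * n)) * (n * n)
          + 6 * (a * a * a) * n * (2 * (b * b) * cb) + 6 * (b * b * b) * n * (2 * (a * a) * ca)
      rhs = solve-∀
    V′-closed : V′ ≡ a * b * (3 * a * b + 1) * (n * n * n) + U′
    V′-closed = begin
      V′
        ≡⟨ regroupV a b a′ b′ n (S₂ a) (S₂ b) ⟩
      2 * (a * a * a) * (b * b * b) * (2 * (n * n * n)) + 12 * (a * a) * (b * b) * (a′ * (b′ * n)) * (n * n)
        + a * a * a * (n * n * n) * (6 * S₂ b) + b * b * b * (n * n * n) * (6 * S₂ a)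
        ≡⟨ cong₂ (λ x y → 2 * (a * a * a) * (b * b * b) * (2 * (n * n * n)) + 12 * (a * a) * (b * b) * (a′ * (b′ * n)) * (n * n)
                          + a * a * a * (n * n * n) * x + b * b * b * (n * n * n) * y) (S₂-closed b′) (S₂-closed a′) ⟩
      2 * (a * a * a) * (b * b * b) * (2 * (n * n * n)) + 12 * (a * a) * (b * b) * (a′ * (b′ * n)) * (n * n)
        + a * a * a * (n * n * n) * (b′ * b * (2 * b′ + 1)) + b * b * b * (n * n * n) * (a′ * a * (2 * a′ + 1))
        ≡⟨ closed-forms a′ b′ n ⟩
      a * b * (3 * a * b + 1) * (n * n * n) + (k * n * (n * n) + a * b * (n * n * n) * (a′ * b′ * (8 * a′ * b′ + 7 * a′ + 7 * b′ + 5)))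
        ≡⟨ cong (λ x → a * b * (3 * a * b + 1) * (n * n * n) + (k * n * (n * n) + a * b * (n * n * n) * x))
                (maxSum⁺-closed a′ b′ a⊥b) ⟨
      a * b * (3 * a * b + 1) * (n * n * n) + (k * n * (n * n) + a * b * (n * n * n) * (12 * M))
        ≡⟨ cong (a * b * (3 * a * b + 1) * (n * n * n) +_) (regroupU a b k n M) ⟩
      a * b * (3 * a * b + 1) * (n * n * n) + U′ ∎
      where
      open ≡-Reasoning
      regroupV : ∀ a b a′ b′ n s₂a s₂b →
        2 * (a * a * a) * (b * b * b) * (2 * (n * n * n)) + 12 * (a * a) * (b * b) * (a′ * (b′ * n)) * (n * n)
          + 6 * (a * a * a) * n * (n * n * s₂b) + 6 * (b * b * b) * n * (n * n * s₂a)
        ≡ 2 * (a * a * a) * (b * b * b) * (2 * (n * n * n)) + 12 * (a * a) * (b * b) * (a′ * (b′ * n)) * (n * n)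
          + a * a * a * (n * n * n) * (6 * s₂b) + b * b * b * (n * n * n) * (6 * s₂a)
      regroupV = solve-∀
      regroupU : ∀ a b k n m → k * n * (n * n) + a * b * (n * n * n) * (12 * m) ≡ k * n * (n * n) + 12 * (a * b) * (n * n) * (n * m)
      regroupU = solve-∀
      closed-forms : ∀ a′ b′ n → let a = suc a′; b = suc b′ in
        2 * (a * a * a) * (b * b * b) * (2 * (n * n * n)) + 12 * (a * a) * (b * b) * (a′ * (b′ * n)) * (n * n)
          + a * a * a * (n * n * n) * (b′ * b * (2 * b′ + 1)) + b * b * b * (n * n * n) * (a′ * a * (2 * a′ + 1))
        ≡ a * b * (3 * a * b + 1) * (n * n * n)
          + (6 * (a * a) * (b * b) * (a * b′ + a′ * b) * n * (n * n)
             + a * b * (n * n * n) * (a′ * b′ * (8 * a′ * b′ + 7 * a′ + 7 * b′ + 5)))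
      closed-forms = solve-∀
    errors : eU + eV ≡ Cᵀ a′ b′ * (n * n)
    errors = total a b a′ b′ n
      where
      total : ∀ a b a′ b′ n →
        6 * (a * a) * (b * b) * (a * b′ + a′ * b) * n * n + 12 * (a * b) * (n * n) * (a′ * (b′ * (a * b)))
        + (2 * (a * a * a) * (b * b * b) * (3 * (n * n)) + 0
           + 6 * (a * a * a) * n * (b′ * (2 * (b * b) * n)) + 6 * (b * b * b) * n * (a′ * (2 * (a * a) * n)))
        ≡ (6 * (a * a) * (b * b) * (a * b′ + a′ * b) + 12 * (a * a) * (b * b) * (a′ * b′)
           + 6 * (a * a * a) * (b * b * b) + 12 * (a * a * a) * (b * b) * b′ + 12 * (a * a) * (b * b * b) * a′) * (n * n)
      total = solve-∀

<2n⇒≡%∨≡%+n : ∀ s n .{{_ : NonZero n}} → s < 2 * n → s ≡ s % n ⊎ s ≡ s % n + n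
<2n⇒≡%∨≡%+n s n s<2n with s / n in s/n≡ | m<n*o⇒m/o<n {s} {2} {n} s<2n
... | 0 | _ = inj₁ (trans (m≡m%n+[m/n]*n s n) (trans (cong (λ k → s % n + k * n) s/n≡) (+-identityʳ (s % n))))
... | 1 | _ = inj₂ (trans (m≡m%n+[m/n]*n s n) (trans (cong (λ k → s % n + k * n) s/n≡) (cong (s % n +_) (+-identityʳ n))))
... | suc (suc _) | s≤s (s≤s ())

residue-difference : ∀ n .{{_ : NonZero n}} A B → B ≤ A →
  (A ∸ B) % n + B % n ≡ A % n ⊎ (A ∸ B) % n + B % n ≡ A % n + n
residue-difference n A B B≤A = subst (λ r → s ≡ r ⊎ s ≡ r + n) s%n≡ (<2n⇒≡%∨≡%+n s n s<2n)
  where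
  s = (A ∸ B) % n + B % n
  s<2n : s < 2 * n
  s<2n = <-≤-trans (+-mono-< (m%n<n (A ∸ B) n) (m%n<n B n)) (≤-reflexive (cong (n +_) (sym (+-identityʳ n))))
  s%n≡ : s % n ≡ A % n
  s%n≡ = trans (sym (%-distribˡ-+ (A ∸ B) B n)) (cong (_% n) (m∸n+n≡m B≤A))

-- u ⊔ v = (u + v + |u - v|) / 2, and the residue w of u - v is |u - v| or n - |u - v|.
max-identity : ∀ n u v w → w < n → (w + v ≡ u ⊎ w + v ≡ u + n) →
  2 * n * (u ⊔ v) + 2 * (u * v) + w * w ≡ n * (u + v) + u * u + v * v + n * w
max-identity n u v w w<n (inj₁ refl) rewrite m≥n⇒m⊔n≡m (m≤n+m v w) = expand n v w
  where
  expand : ∀ n v w → 2 * n * (w + v) + 2 * ((w + v) * v) + w * w ≡ n * ((w + v) + v) + (w + v) * (w + v) + v * v + n * w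
  expand = solve-∀
max-identity n u v w w<n (inj₂ w+v≡u+n) = u<v-case
  where
  u<v : u < v
  u<v = +-cancelˡ-< n u v (begin-strict
    n + u ≡⟨ +-comm n u ⟩
    u + n ≡⟨ w+v≡u+n ⟨
    w + v <⟨ +-monoˡ-< v w<n ⟩
    n + v ∎)
    where open ≤-Reasoning
  t = v ∸ u
  v≡u+t : v ≡ u + t
  v≡u+t = sym (m+[n∸m]≡n (<⇒≤ u<v))
  n≡w+t : n ≡ w + t
  n≡w+t = +-cancelˡ-≡ u n (w + t) (trans (sym w+v≡u+n) (trans (cong (w +_) v≡u+t) (swap w u t)))
    where
    swap : ∀ w u t → w + (u + t) ≡ u + (w + t)
    swap = solve-∀
  expand : ∀ u t w → 2 * (w + t) * (u + t) + 2 * (u * (u + t)) + w * w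
                     ≡ (w + t) * (u + (u + t)) + u * u + (u + t) * (u + t) + (w + t) * w
  expand = solve-∀
  u<v-case : 2 * n * (u ⊔ v) + 2 * (u * v) + w * w ≡ n * (u + v) + u * u + v * v + n * w
  u<v-case rewrite m≤n⇒m⊔n≡n (<⇒≤ u<v) | v≡u+t | n≡w+t = expand u t w

module ResidueMaxima (a′ b′ n′ : ℕ) where

  open FloorPair a′ b′ n′ public
  open ResidueProducts a′ b′ n′ public

  d : ℕ
  d = ∣ a - b ∣

  w : ℕ → ℕ
  w x = (d * x) % n

  Sm : ℕ
  Sm = ∑[ x < n ] (A.r x ⊔ B.r x)

  max-identityₓ : ∀ x → 2 * n * (A.r x ⊔ B.r x) + 2 * (A.r x * B.r x) + w x * w x
                        ≡ n * (A.r x + B.r x) + A.r x * A.r x + B.r x * B.r x + n * w x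
  max-identityₓ x with ≤-total b a
  ... | inj₁ b≤a = max-identity n (A.r x) (B.r x) (w x) (m%n<n (d * x) n)
                     (subst (λ k → k % n + B.r x ≡ A.r x ⊎ k % n + B.r x ≡ A.r x + n) (sym dx)
                            (residue-difference n (a * x) (b * x) (*-monoˡ-≤ x b≤a)))
    where
    dx : d * x ≡ a * x ∸ b * x
    dx = trans (cong (_* x) (m≤n⇒∣n-m∣≡n∸m b≤a)) (*-distribʳ-∸ x a b)
  ... | inj₂ a≤b = begin
    2 * n * (A.r x ⊔ B.r x) + 2 * (A.r x * B.r x) + w x * w x
      ≡⟨ cong₂ (λ s t → 2 * n * s + 2 * t + w x * w x) (⊔-comm (A.r x) (B.r x)) (*-comm (A.r x) (B.r x)) ⟩
    2 * n * (B.r x ⊔ A.r x) + 2 * (B.r x * A.r x) + w x * w x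
      ≡⟨ max-identity n (B.r x) (A.r x) (w x) (m%n<n (d * x) n)
           (subst (λ k → k % n + A.r x ≡ B.r x ⊎ k % n + A.r x ≡ B.r x + n) (sym dx)
                  (residue-difference n (b * x) (a * x) (*-monoˡ-≤ x a≤b))) ⟩
    n * (B.r x + A.r x) + B.r x * B.r x + A.r x * A.r x + n * w x
      ≡⟨ swap n (A.r x) (B.r x) (w x) ⟩
    n * (A.r x + B.r x) + A.r x * A.r x + B.r x * B.r x + n * w x ∎
    where
    open ≡-Reasoning
    dx : d * x ≡ b * x ∸ a * x
    dx = trans (cong (_* x) (m≤n⇒∣m-n∣≡n∸m a≤b)) (*-distribʳ-∸ x b a)
    swap : ∀ n u v w → n * (v + u) + v * v + u * u + n * w ≡ n * (u + v) + u * u + v * v + n * w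
    swap = solve-∀

  max-sum : Coprime n a → Coprime n b → Coprime n d → 2 * n * Sm + 2 * T ≡ 3 * n * S₁ n + S₂ n
  max-sum n⊥a n⊥b n⊥d = +-cancelʳ-≡ (S₂ n) _ _ (begin
    2 * n * Sm + 2 * T + S₂ n
      ≡⟨ cong₂ (λ s t → s + t + S₂ n) (sym (∑-distribˡ n (2 * n) _)) (sym (∑-distribˡ n 2 _)) ⟩
    ∑[ x < n ] (2 * n * (A.r x ⊔ B.r x)) + ∑[ x < n ] (2 * (A.r x * B.r x)) + S₂ n
      ≡⟨ cong₂ _+_ (sym (∑-distrib-+ n _ _)) (sym (∑-permute-affine n d 0 (λ y → y * y) n⊥d)) ⟩
    ∑[ x < n ] (2 * n * (A.r x ⊔ B.r x) + 2 * (A.r x * B.r x)) + ∑[ x < n ] (w x * w x)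
      ≡⟨ sym (∑-distrib-+ n _ _) ⟩
    ∑[ x < n ] (2 * n * (A.r x ⊔ B.r x) + 2 * (A.r x * B.r x) + w x * w x)
      ≡⟨ ∑-cong n (λ x _ → max-identityₓ x) ⟩
    ∑[ x < n ] (n * (A.r x + B.r x) + A.r x * A.r x + B.r x * B.r x + n * w x)
      ≡⟨ distribute ⟩
    n * (∑ n A.r + ∑ n B.r) + ∑[ x < n ] (A.r x * A.r x) + ∑[ x < n ] (B.r x * B.r x) + n * ∑ n w
      ≡⟨ cong₂ (λ s t → n * s + ∑[ x < n ] (A.r x * A.r x) + ∑[ x < n ] (B.r x * B.r x) + n * t)
               (cong₂ _+_ (permuted a n⊥a (λ y → y)) (permuted b n⊥b (λ y → y))) (permuted d n⊥d (λ y → y)) ⟩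
    n * (S₁ n + S₁ n) + ∑[ x < n ] (A.r x * A.r x) + ∑[ x < n ] (B.r x * B.r x) + n * S₁ n
      ≡⟨ cong₂ (λ s t → n * (S₁ n + S₁ n) + s + t + n * S₁ n)
               (permuted a n⊥a (λ y → y * y)) (permuted b n⊥b (λ y → y * y)) ⟩
    n * (S₁ n + S₁ n) + S₂ n + S₂ n + n * S₁ n
      ≡⟨ collect n (S₁ n) (S₂ n) ⟩
    3 * n * S₁ n + S₂ n + S₂ n ∎)
    where
    open ≡-Reasoning
    permuted : ∀ k → Coprime n k → (f : ℕ → ℕ) → ∑[ x < n ] f ((k * x) % n) ≡ ∑ n f
    permuted k n⊥k f = ∑-permute-affine n k 0 f n⊥k
    distribute : ∑[ x < n ] (n * (A.r x + B.r x) + A.r x * A.r x + B.r x * B.r x + n * w x)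
                 ≡ n * (∑ n A.r + ∑ n B.r) + ∑[ x < n ] (A.r x * A.r x) + ∑[ x < n ] (B.r x * B.r x) + n * ∑ n w
    distribute = trans (∑-distrib-+ n _ _)
      (cong₂ _+_ (trans (∑-distrib-+ n _ _) (cong (_+ ∑[ x < n ] (B.r x * B.r x)) (trans (∑-distrib-+ n _ _)
                   (cong (_+ ∑[ x < n ] (A.r x * A.r x)) (trans (∑-distribˡ n n _) (cong (n *_) (∑-distrib-+ n A.r B.r)))))))
                 (∑-distribˡ n n w))
    collect : ∀ n s₁ s₂ → n * (s₁ + s₁) + s₂ + s₂ + n * s₁ ≡ 3 * n * s₁ + s₂ + s₂
    collect = solve-∀

  -- By max-sum, 2 n Sm = 3 n S₁ n + S₂ n - 2 T: insert T≈ and the power-sum approximations, then divide by 2 a b n.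
  Sm≈ : Coprime a b → Coprime n a → Coprime n b → Coprime n d →
        12 * (a * b) * Sm + n * n ≈[ Cᵐ a′ b′ * n ] 8 * (a * b) * (n * n)
  Sm≈ a⊥b n⊥a n⊥b n⊥d = ≈-cancelˡ-* (2 * (a * b) * n) (≈-mono weaken (≈-cancelʳ-+ (6 * (a * a) * (b * b) * (n * n * n))
    (≈-resp (L′-regroup a b n Sm) refl (R′-regroup a b n)
      (≈-trans (≈-+ (≈-refl {0} _) (≈-* 2 (≈-sym (T≈ a⊥b)))) (≈-resp (sym balance) refl refl R≈R′)))))
    where
    R R′ eR : ℕ
    R  = 18 * (a * a) * (b * b) * n * (2 * S₁ n) + 2 * (a * a) * (b * b) * (6 * S₂ n)
    R′ = 18 * (a * a) * (b * b) * n * (n * n) + 2 * (a * a) * (b * b) * (2 * (n * n * n))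
    eR = 18 * (a * a) * (b * b) * n * n + 2 * (a * a) * (b * b) * (3 * (n * n))
    R≈R′ : R ≈[ eR ] R′
    R≈R′ = ≈-+ (≈-* (18 * (a * a) * (b * b) * n) (2S₁≈n² n)) (≈-* (2 * (a * a) * (b * b)) (6S₂≈2n³ n))
    balance : 2 * (a * b) * n * (12 * (a * b) * Sm) + 2 * (12 * (a * a) * (b * b) * T) ≡ R
    balance = begin
      2 * (a * b) * n * (12 * (a * b) * Sm) + 2 * (12 * (a * a) * (b * b) * T)
        ≡⟨ lhs a b n Sm T ⟩
      12 * (a * a) * (b * b) * (2 * n * Sm + 2 * T)
        ≡⟨ cong (12 * (a * a) * (b * b) *_) (max-sum n⊥a n⊥b n⊥d) ⟩
      12 * (a * a) * (b * b) * (3 * n * S₁ n + S₂ n)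
        ≡⟨ rhs a b n (S₁ n) (S₂ n) ⟩
      R ∎
      where
      open ≡-Reasoning
      lhs : ∀ a b n s t → 2 * (a * b) * n * (12 * (a * b) * s) + 2 * (12 * (a * a) * (b * b) * t)
                          ≡ 12 * (a * a) * (b * b) * (2 * n * s + 2 * t)
      lhs = solve-∀
      rhs : ∀ a b n s₁ s₂ → 12 * (a * a) * (b * b) * (3 * n * s₁ + s₂)
                            ≡ 18 * (a * a) * (b * b) * n * (2 * s₁) + 2 * (a * a) * (b * b) * (6 * s₂)
      rhs = solve-∀
    L′-regroup : ∀ a b n s → 2 * (a * b) * n * (12 * (a * b) * s) + 2 * (a * b * (3 * a * b + 1) * (n * n * n))
                             ≡ 2 * (a * b) * n * (12 * (a * b) * s + n * n) + 6 * (a * a) * (b * b) * (n * n * n)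
    L′-regroup = solve-∀
    R′-regroup : ∀ a b n → 18 * (a * a) * (b * b) * n * (n * n) + 2 * (a * a) * (b * b) * (2 * (n * n * n))
                           ≡ 2 * (a * b) * n * (8 * (a * b) * (n * n)) + 6 * (a * a) * (b * b) * (n * n * n)
    R′-regroup = solve-∀
    weaken : 2 * (Cᵀ a′ b′ * (n * n)) + eR ≤ 2 * (a * b) * n * (Cᵐ a′ b′ * n)
    weaken = begin
      2 * (Cᵀ a′ b′ * (n * n)) + eR      ≡⟨ collect a b n (Cᵀ a′ b′) ⟩
      1 * (n * (Cᵐ a′ b′ * n))           ≤⟨ *-monoˡ-≤ (n * (Cᵐ a′ b′ * n)) {1} {2 * (a * b)} (s≤s z≤n) ⟩
      2 * (a * b) * (n * (Cᵐ a′ b′ * n)) ≡⟨ *-assoc (2 * (a * b)) n (Cᵐ a′ b′ * n) ⟨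
      2 * (a * b) * n * (Cᵐ a′ b′ * n)   ∎
      where
      open ≤-Reasoning
      collect : ∀ a b n c → 2 * (c * (n * n)) + (18 * (a * a) * (b * b) * n * n + 2 * (a * a) * (b * b) * (3 * (n * n)))
                            ≡ 1 * (n * ((2 * c + 24 * (a * a) * (b * b)) * n))
      collect = solve-∀

rep≡% : ∀ m k .{{_ : NonZero m}} → k % m ≢ 0 → rep m k ≡ k % m
rep≡% m k k%m≢0 with k % m
... | zero  = ⊥-elim (k%m≢0 refl)
... | suc _ = refl

rep-cong : ∀ m k k′ .{{_ : NonZero m}} → k % m ≡ k′ % m → rep m k ≡ rep m k′
rep-cong m k k′ k%m≡k′%m with k % m | k′ % m
... | zero  | zero  = refl
... | suc _ | suc _ = k%m≡k′%m
... | zero  | suc _ = ⊥-elim (0≢1+n k%m≡k′%m)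
... | suc _ | zero  = ⊥-elim (1+n≢0 k%m≡k′%m)

*%≢0 : ∀ n .{{_ : NonZero n}} k x → Coprime n k → 0 < x → x < n → (k * x) % n ≢ 0
*%≢0 n k x n⊥k 0<x x<n kx%n≡0 = <⇒≢ 0<x (sym (∣∧<⇒≡0 (coprime-divisor n⊥k (m%n≡0⇒n∣m (k * x) n kx%n≡0)) x<n))

module Reduction (a′ b′ g′ n′ : ℕ) where

  open ResidueMaxima a′ b′ n′ public

  g : ℕ
  g = suc g′

  Ma≡n+Sm : Coprime n a → Coprime n b → Coprime n g → Ma (a * g) (b * g) n ≡ n + Sm
  Ma≡n+Sm n⊥a n⊥b n⊥g = begin
    Ma (a * g) (b * g) n
      ≡⟨ sum-upTo n _ ⟩
    ∑[ x < n ] (rep n (a * g * x) ⊔ rep n (b * g * x))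
      ≡⟨ ∑-cong n (λ x _ → cong₂ _⊔_ (absorb a x) (absorb b x)) ⟩
    ∑[ x < n ] F ((g * x) % n)
      ≡⟨ ∑-permute-affine n g 0 F n⊥g ⟩
    ∑ n F
      ≡⟨ ∑-suc n′ F ⟩
    F 0 + ∑[ x < n′ ] F (suc x)
      ≡⟨ cong₂ _+_ F0≡n (∑-cong n′ (λ x x<n′ → cong₂ _⊔_ (rep≡% n (a * suc x) (*%≢0 n a (suc x) n⊥a z<s (s≤s x<n′)))
                                                      (rep≡% n (b * suc x) (*%≢0 n b (suc x) n⊥b z<s (s≤s x<n′))))) ⟩
    n + ∑[ x < n′ ] (A.r (suc x) ⊔ B.r (suc x))
      ≡⟨ cong (n +_) (trans (∑-suc n′ (λ x → A.r x ⊔ B.r x)) (cong (_+ ∑[ x < n′ ] (A.r (suc x) ⊔ B.r (suc x))) r0≡0)) ⟨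
    n + Sm ∎
    where
    open ≡-Reasoning
    F : ℕ → ℕ
    F y = rep n (a * y) ⊔ rep n (b * y)
    absorb : ∀ k x → rep n (k * g * x) ≡ rep n (k * ((g * x) % n))
    absorb k x = rep-cong n (k * g * x) (k * ((g * x) % n)) (begin
      (k * g * x) % n                   ≡⟨ cong (_% n) (*-assoc k g x) ⟩
      (k * (g * x)) % n                 ≡⟨ %-distribˡ-* k (g * x) n ⟩
      ((k % n) * ((g * x) % n)) % n     ≡⟨ cong (λ y → ((k % n) * y) % n) (m%n%n≡m%n (g * x) n) ⟨
      ((k % n) * ((g * x) % n % n)) % n ≡⟨ %-distribˡ-* k ((g * x) % n) n ⟨
      (k * ((g * x) % n)) % n           ∎)
    F0≡n : F 0 ≡ n
    F0≡n rewrite *-zeroʳ a | *-zeroʳ b = ⊔-idem n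
    r0≡0 : A.r 0 ⊔ B.r 0 ≡ 0
    r0≡0 rewrite *-zeroʳ a | *-zeroʳ b = refl

  Ma≈ : Coprime a b → Coprime n a → Coprime n b → Coprime n g → Coprime n d →
        12 * (a * g) * (b * g) * Ma (a * g) (b * g) n + g * g * (n * n)
          ≈[ g * g * (Cᵐ a′ b′ + 12 * (a * b)) * n ] 8 * (a * g) * (b * g) * (n * n)
  Ma≈ a⊥b n⊥a n⊥b n⊥g n⊥d =
    subst (λ m → 12 * (a * g) * (b * g) * m + g * g * (n * n) ≈[ g * g * (Cᵐ a′ b′ + 12 * (a * b)) * n ] 8 * (a * g) * (b * g) * (n * n))
          (sym (Ma≡n+Sm n⊥a n⊥b n⊥g))
      (≈-resp (lhs a b g n Sm) (error g (Cᵐ a′ b′) a b n) (rhs a b g n)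
        (≈-* (g * g) (≈-+ (Sm≈ a⊥b n⊥a n⊥b n⊥d) (m≈0 (12 * (a * b) * n)))))
    where
    m≈0 : ∀ m → m ≈[ m ] 0
    m≈0 m = ≤-refl , z≤n
    lhs : ∀ a b g n s → g * g * (12 * (a * b) * s + n * n + 12 * (a * b) * n)
                        ≡ 12 * (a * g) * (b * g) * (n + s) + g * g * (n * n)
    lhs = solve-∀
    error : ∀ g c a b n → g * g * (c * n + 12 * (a * b) * n) ≡ g * g * (c + 12 * (a * b)) * n
    error = solve-∀
    rhs : ∀ a b g n → g * g * (8 * (a * b) * (n * n) + 0) ≡ 8 * (a * g) * (b * g) * (n * n)
    rhs = solve-∀

  Ma≈-prime : Coprime a b → a ≢ b → Prime n → a * g + b * g < n → gcd (a * g) (b * g) ≡ g →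
    12 * (a * g) * (b * g) * Ma (a * g) (b * g) n + gcd (a * g) (b * g) * gcd (a * g) (b * g) * (n * n)
      ≈[ g * g * (Cᵐ a′ b′ + 12 * (a * b)) * n ] 8 * (a * g) * (b * g) * (n * n)
  Ma≈-prime a⊥b a≢b n-prime q₁+q₂<n gcd≡g rewrite gcd≡g =
    Ma≈ a⊥b (coprime a<n) (coprime b<n) (coprime g<n) (prime⇒coprime n-prime {{d≢0}} (≤-<-trans (∣m-n∣≤m⊔n a b) (⊔-lub a<n b<n)))
    where
    coprime : ∀ {k} .{{_ : NonZero k}} → k < n → Coprime n k
    coprime = prime⇒coprime n-prime
    a<n : a < n
    a<n = ≤-<-trans (≤-trans (m≤m*n a g) (m≤m+n (a * g) (b * g))) q₁+q₂<n
    b<n : b < n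
    b<n = ≤-<-trans (≤-trans (m≤m*n b g) (m≤n+m (b * g) (a * g))) q₁+q₂<n
    g<n : g < n
    g<n = ≤-<-trans (≤-trans (m≤n*m g a) (m≤m+n (a * g) (b * g))) q₁+q₂<n
    d≢0 : NonZero d
    d≢0 = ≢-nonZero (a≢b ∘ ∣m-n∣≡0⇒m≡n)

record GcdSplit (q₁ q₂ : ℕ) : Set where
  field
    a′ b′ g′ : ℕ
    q₁≡ : q₁ ≡ suc a′ * suc g′
    q₂≡ : q₂ ≡ suc b′ * suc g′
    gcd≡ : gcd q₁ q₂ ≡ suc g′
    coprime : Coprime (suc a′) (suc b′)

gcd-split : ∀ q₁ q₂ .{{_ : NonZero q₁}} .{{_ : NonZero q₂}} → GcdSplit q₁ q₂
gcd-split q₁ q₂ = record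
  { a′ = pred a ; b′ = pred b ; g′ = pred g
  ; q₁≡ = sym (trans (cong₂ _*_ (suc-pred a) (suc-pred g)) (m/n*n≡m (gcd[m,n]∣m q₁ q₂)))
  ; q₂≡ = sym (trans (cong₂ _*_ (suc-pred b) (suc-pred g)) (m/n*n≡m (gcd[m,n]∣n q₁ q₂)))
  ; gcd≡ = sym (suc-pred g)
  ; coprime = subst₂ Coprime (sym (suc-pred a)) (sym (suc-pred b)) (coprime-/gcd q₁ q₂)
  }
  where
  g = gcd q₁ q₂
  instance
    g≢0 : NonZero g
    g≢0 = ≢-nonZero (gcd[m,n]≢0 q₁ q₂ (inj₁ (≢-nonZero⁻¹ q₁)))
  a b : ℕ
  a = q₁ / g
  b = q₂ / g
  instance
    a≢0 : NonZero a
    a≢0 = ≢-nonZero (m/gcd[m,n]≢0 q₁ q₂)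
    b≢0 : NonZero b
    b≢0 = ≢-nonZero (n/gcd[m,n]≢0 q₁ q₂)

Ma-asymptotic : ∀ q₁ q₂ .{{_ : NonZero q₁}} .{{_ : NonZero q₂}} → q₁ ≢ q₂ →
  ∃[ K ] ∀ p → Prime p → q₁ + q₂ < p →
    12 * q₁ * q₂ * Ma q₁ q₂ p + gcd q₁ q₂ * gcd q₁ q₂ * (p * p) ≈[ K * p ] 8 * q₁ * q₂ * (p * p)
Ma-asymptotic q₁ q₂ q₁≢q₂ with gcd-split q₁ q₂
... | record { a′ = a′ ; b′ = b′ ; g′ = g′ ; q₁≡ = refl ; q₂≡ = refl ; gcd≡ = gcd≡ ; coprime = a⊥b } =
  suc g′ * suc g′ * (Cᵐ a′ b′ + 12 * (suc a′ * suc b′)) ,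
  λ { (suc n′) p-prime q₁+q₂<p →
        Reduction.Ma≈-prime a′ b′ g′ n′ a⊥b (q₁≢q₂ ∘ cong (_* suc g′)) p-prime q₁+q₂<p gcd≡ }

-- Passing to ℚ

open +-*-Solver

ι : ℕ → ℚ
ι n = ℤ.+ n ℚ./ 1

toℚᵘ-ι : ∀ n → toℚᵘ (ι n) ℚᵘ.≃ mkℚᵘ (ℤ.+ n) 0
toℚᵘ-ι n = ℚ.toℚᵘ-fromℚᵘ (mkℚᵘ (ℤ.+ n) 0)

ι-homo-+ : ∀ m n → ι (m + n) ≡ ι m ℚ.+ ι n
ι-homo-+ m n = ℚ.toℚᵘ-injective (ℚᵘ.≃-trans (toℚᵘ-ι (m + n)) (ℚᵘ.≃-trans (*≡* (cross (ℤ.+ m) (ℤ.+ n)))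
  (ℚᵘ.≃-sym (ℚᵘ.≃-trans (ℚ.toℚᵘ-homo-+ (ι m) (ι n)) (ℚᵘ.+-cong (toℚᵘ-ι m) (toℚᵘ-ι n))))))
  where
  cross : ∀ x y → (x ℤ.+ y) ℤ.* ℤ.+ 1 ≡ (x ℤ.* ℤ.+ 1 ℤ.+ y ℤ.* ℤ.+ 1) ℤ.* ℤ.+ 1
  cross x y = cong (ℤ._* ℤ.+ 1) (sym (cong₂ ℤ._+_ (ℤ.*-identityʳ x) (ℤ.*-identityʳ y)))

ι-homo-* : ∀ m n → ι (m * n) ≡ ι m ℚ.* ι n
ι-homo-* m n = ℚ.toℚᵘ-injective (ℚᵘ.≃-trans (toℚᵘ-ι (m * n)) (ℚᵘ.≃-trans (*≡* (cong (ℤ._* ℤ.+ 1) (ℤ.pos-* m n)))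
  (ℚᵘ.≃-sym (ℚᵘ.≃-trans (ℚ.toℚᵘ-homo-* (ι m) (ι n)) (ℚᵘ.*-cong (toℚᵘ-ι m) (toℚᵘ-ι n))))))

ι-mono-≤ : ∀ {m n} → m ≤ n → ι m ℚ.≤ ι n
ι-mono-≤ {m} {n} m≤n =
  ℚ.toℚᵘ-cancel-≤ (ℚᵘ.≤-respˡ-≃ (ℚᵘ.≃-sym (toℚᵘ-ι m)) (ℚᵘ.≤-respʳ-≃ (ℚᵘ.≃-sym (toℚᵘ-ι n))
  (*≤* (subst₂ ℤ._≤_ (sym (ℤ.*-identityʳ (ℤ.+ m))) (sym (ℤ.*-identityʳ (ℤ.+ n))) (ℤ.+≤+ m≤n)))))

ι-nonNeg : ∀ n → ℚ.NonNegative (ι n)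
ι-nonNeg n = ℚ.normalize-nonNeg n 1

ι*/ : ∀ D F x m .{{_ : NonZero m}} → D * x ≡ F * m → ι D ℚ.* (ℤ.+ x ℚ./ m) ≡ ι F
ι*/ D F x (suc m′) Dx≡Fm = ℚ.toℚᵘ-injective (ℚᵘ.≃-trans (ℚ.toℚᵘ-homo-* (ι D) (ℤ.+ x ℚ./ suc m′))
  (ℚᵘ.≃-trans (ℚᵘ.*-cong (toℚᵘ-ι D) (ℚ.toℚᵘ-fromℚᵘ (mkℚᵘ (ℤ.+ x) m′)))
              (ℚᵘ.≃-trans (*≡* cross) (ℚᵘ.≃-sym (toℚᵘ-ι F)))))
  where
  cross : (ℤ.+ D ℤ.* ℤ.+ x) ℤ.* ℤ.+ 1 ≡ ℤ.+ F ℤ.* ℤ.+ suc (m′ + 0)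
  cross = begin
    (ℤ.+ D ℤ.* ℤ.+ x) ℤ.* ℤ.+ 1 ≡⟨ ℤ.*-identityʳ _ ⟩
    ℤ.+ D ℤ.* ℤ.+ x             ≡⟨ ℤ.pos-* D x ⟨
    ℤ.+ (D * x)                 ≡⟨ cong ℤ.+_ Dx≡Fm ⟩
    ℤ.+ (F * suc m′)            ≡⟨ ℤ.pos-* F (suc m′) ⟩
    ℤ.+ F ℤ.* ℤ.+ suc m′        ≡⟨ cong (λ k → ℤ.+ F ℤ.* ℤ.+ suc k) (+-identityʳ m′) ⟨
    ℤ.+ F ℤ.* ℤ.+ suc (m′ + 0)  ∎
    where open ≡-Reasoning

x+k-x≡k : ∀ x k → x ℚ.+ k ℚ.- x ≡ k
x+k-x≡k = solve 2 (λ x k → x :+ k :- x := k) refl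

∣-∣≤ : ∀ {y z k} → y ℚ.≤ z ℚ.+ k → z ℚ.≤ y ℚ.+ k → ℚ.∣ y ℚ.- z ∣ ℚ.≤ k
∣-∣≤ {y} {z} {k} y≤ z≤ with ℚ.∣p∣≡p∨∣p∣≡-p (y ℚ.- z)
... | inj₁ ∣y-z∣≡y-z = subst (ℚ._≤ k) (sym ∣y-z∣≡y-z) (begin
  y ℚ.- z       ≤⟨ ℚ.+-monoˡ-≤ (ℚ.- z) y≤ ⟩
  z ℚ.+ k ℚ.- z ≡⟨ x+k-x≡k z k ⟩
  k             ∎)
  where open ℚ.≤-Reasoning
... | inj₂ ∣y-z∣≡z-y = subst (ℚ._≤ k) (sym ∣y-z∣≡z-y) (begin
  ℚ.- (y ℚ.- z) ≡⟨ negate y z ⟩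
  z ℚ.- y       ≤⟨ ℚ.+-monoˡ-≤ (ℚ.- y) z≤ ⟩
  y ℚ.+ k ℚ.- y ≡⟨ x+k-x≡k y k ⟩
  k             ∎)
  where
  open ℚ.≤-Reasoning
  negate : ∀ y z → ℚ.- (y ℚ.- z) ≡ z ℚ.- y
  negate = solve 2 (λ y z → :- (y :- z) := z :- y) refl

-- Multiplied by D, the relative error becomes |D M + H P - F P| / (D P c), since D c = F - H.
relative-error : ∀ {M P D F H e} (c ε : ℚ) .{{_ : NonZero D}} → D * M + H * P ≈[ e ] F * P →
  ι D ℚ.* c ≡ ι F ℚ.- ι H → ι e ℚ.≤ ε ℚ.* (ι P ℚ.* (ι F ℚ.- ι H)) →
  ℚ.∣ ι M ℚ.- ι P ℚ.* c ∣ ℚ.≤ ε ℚ.* (ι P ℚ.* c)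
relative-error {M} {P} {D} {F} {H} {e} c ε (upper , lower) Dc≡F-H e≤ =
  ℚ.*-cancelˡ-≤-pos (ι D) {{ℚ.normalize-pos D 1}} (begin
    ι D ℚ.* ℚ.∣ ι M ℚ.- ι P ℚ.* c ∣
      ≡⟨ cong (ℚ._* ℚ.∣ ι M ℚ.- ι P ℚ.* c ∣) (ℚ.0≤p⇒∣p∣≡p (ℚ.nonNegative⁻¹ (ι D) {{ι-nonNeg D}})) ⟨
    ℚ.∣ ι D ∣ ℚ.* ℚ.∣ ι M ℚ.- ι P ℚ.* c ∣
      ≡⟨ ℚ.∣p*q∣≡∣p∣*∣q∣ (ι D) _ ⟨
    ℚ.∣ ι D ℚ.* (ι M ℚ.- ι P ℚ.* c) ∣
      ≡⟨ cong ℚ.∣_∣ scaled ⟩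
    ℚ.∣ ι (D * M + H * P) ℚ.- ι (F * P) ∣
      ≤⟨ ∣-∣≤ (subst (ι (D * M + H * P) ℚ.≤_) (ι-homo-+ (F * P) e) (ι-mono-≤ upper))
              (subst (ι (F * P) ℚ.≤_) (ι-homo-+ (D * M + H * P) e) (ι-mono-≤ lower)) ⟩
    ι e
      ≤⟨ e≤ ⟩
    ε ℚ.* (ι P ℚ.* (ι F ℚ.- ι H))
      ≡⟨ cong (λ r → ε ℚ.* (ι P ℚ.* r)) Dc≡F-H ⟨
    ε ℚ.* (ι P ℚ.* (ι D ℚ.* c))
      ≡⟨ shuffle ε (ι P) (ι D) c ⟩
    ι D ℚ.* (ε ℚ.* (ι P ℚ.* c)) ∎)
  where
  open ℚ.≤-Reasoning
  shuffle : ∀ ε p d c → ε ℚ.* (p ℚ.* (d ℚ.* c)) ≡ d ℚ.* (ε ℚ.* (p ℚ.* c))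
  shuffle = solve 4 (λ ε p d c → ε :* (p :* (d :* c)) := d :* (ε :* (p :* c))) refl
  expand : ∀ d m p c → d ℚ.* (m ℚ.- p ℚ.* c) ≡ d ℚ.* m ℚ.- p ℚ.* (d ℚ.* c)
  expand = solve 4 (λ d m p c → d :* (m :- p :* c) := d :* m :- p :* (d :* c)) refl
  regroup : ∀ d m p f h → d ℚ.* m ℚ.- p ℚ.* (f ℚ.- h) ≡ (d ℚ.* m ℚ.+ h ℚ.* p) ℚ.- f ℚ.* p
  regroup = solve 5 (λ d m p f h → d :* m :- p :* (f :- h) := (d :* m :+ h :* p) :- f :* p) refl
  scaled : ι D ℚ.* (ι M ℚ.- ι P ℚ.* c) ≡ ι (D * M + H * P) ℚ.- ι (F * P)
  scaled = begin-equality
    ι D ℚ.* (ι M ℚ.- ι P ℚ.* c)                   ≡⟨ expand (ι D) (ι M) (ι P) c ⟩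
    ι D ℚ.* ι M ℚ.- ι P ℚ.* (ι D ℚ.* c)           ≡⟨ cong (λ r → ι D ℚ.* ι M ℚ.- ι P ℚ.* r) Dc≡F-H ⟩
    ι D ℚ.* ι M ℚ.- ι P ℚ.* (ι F ℚ.- ι H)         ≡⟨ regroup (ι D) (ι M) (ι P) (ι F) (ι H) ⟩
    (ι D ℚ.* ι M ℚ.+ ι H ℚ.* ι P) ℚ.- ι F ℚ.* ι P ≡⟨ cong₂ ℚ._-_ (sym ι-numerator) (sym (ι-homo-* F P)) ⟩
    ι (D * M + H * P) ℚ.- ι (F * P)               ∎
    where
    ι-numerator : ι (D * M + H * P) ≡ ι D ℚ.* ι M ℚ.+ ι H ℚ.* ι P
    ι-numerator = trans (ι-homo-+ (D * M) (H * P)) (cong₂ ℚ._+_ (ι-homo-* D M) (ι-homo-* H P))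

mainConst-scaled : ∀ q₁ q₂ .{{_ : NonZero q₁}} .{{_ : NonZero q₂}} →
  ι (12 * q₁ * q₂) ℚ.* mainConst q₁ q₂ ≡ ι (8 * q₁ * q₂) ℚ.- ι (gcd q₁ q₂ * gcd q₁ q₂)
mainConst-scaled q₁ q₂ = trans (distrib (ι D) (ℤ.+ 2 ℚ./ 3) (ℤ.+ H ℚ./ D))
  (cong₂ ℚ._-_ (ι*/ D (8 * q₁ * q₂) 2 3 (twelve-eighths q₁ q₂)) (ι*/ D H H D (*-comm D H)))
  where
  D H : ℕ
  D = 12 * q₁ * q₂
  H = gcd q₁ q₂ * gcd q₁ q₂
  instance
    D≢0 : NonZero D
    D≢0 = m*n≢0 (12 * q₁) q₂ {{m*n≢0 12 q₁}}
  distrib : ∀ d x y → d ℚ.* (x ℚ.- y) ≡ d ℚ.* x ℚ.- d ℚ.* y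
  distrib = solve 3 (λ d x y → d :* (x :- y) := d :* x :- d :* y) refl
  twelve-eighths : ∀ a b → 12 * a * b * 2 ≡ 8 * a * b * 3
  twelve-eighths = solve-∀

gcd²<8q₁q₂ : ∀ q₁ q₂ .{{_ : NonZero q₁}} .{{_ : NonZero q₂}} →
             gcd q₁ q₂ * gcd q₁ q₂ + 1 ≤ 8 * q₁ * q₂
gcd²<8q₁q₂ q₁ q₂ = begin
  gcd q₁ q₂ * gcd q₁ q₂ + 1         ≤⟨ +-mono-≤ (*-mono-≤ (∣⇒≤ (gcd[m,n]∣m q₁ q₂)) (∣⇒≤ (gcd[m,n]∣n q₁ q₂)))
                                                 (>-nonZero⁻¹ (q₁ * q₂) {{m*n≢0 q₁ q₂}}) ⟩
  q₁ * q₂ + q₁ * q₂                 ≤⟨ m≤m+n (q₁ * q₂ + q₁ * q₂) (6 * (q₁ * q₂)) ⟩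
  q₁ * q₂ + q₁ * q₂ + 6 * (q₁ * q₂) ≡⟨ eight q₁ q₂ ⟩
  8 * q₁ * q₂                       ∎
  where
  open ≤-Reasoning
  eight : ∀ a b → a * b + a * b + 6 * (a * b) ≡ 8 * a * b
  eight = solve-∀

archimedean : ∀ K (ε : ℚ) → 0ℚ ℚ.< ε → ∃[ N ] (∀ p → N ≤ p → ι K ℚ.≤ ε ℚ.* ι p)
archimedean K ε@(mkℚ (ℤ.+ suc k) d′ _) _ = K * suc d′ , λ p Kd≤p → begin
  ι K                        ≤⟨ ι-mono-≤ (m≤m*n K (suc k)) ⟩
  ι (K * suc k)              ≡⟨ ι-homo-* K (suc k) ⟩
  ι K ℚ.* ι (suc k)          ≡⟨ cong (ι K ℚ.*_) d·ε≡k ⟨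
  ι K ℚ.* (ι (suc d′) ℚ.* ε) ≡⟨ shuffle (ι K) (ι (suc d′)) ε ⟩
  ε ℚ.* (ι K ℚ.* ι (suc d′)) ≡⟨ cong (ε ℚ.*_) (ι-homo-* K (suc d′)) ⟨
  ε ℚ.* ι (K * suc d′)       ≤⟨ ℚ.*-monoˡ-≤-nonNeg ε {{_}} (ι-mono-≤ Kd≤p) ⟩
  ε ℚ.* ι p                  ∎
  where
  open ℚ.≤-Reasoning
  d·ε≡k : ι (suc d′) ℚ.* ε ≡ ι (suc k)
  d·ε≡k = trans (cong (ι (suc d′) ℚ.*_) (sym (ℚ.↥p/↧p≡p ε)))
                (ι*/ (suc d′) (suc k) (suc k) (suc d′) (*-comm (suc d′) (suc k)))
  shuffle : ∀ x y z → x ℚ.* (y ℚ.* z) ≡ z ℚ.* (x ℚ.* y)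
  shuffle = solve 3 (λ x y z → x :* (y :* z) := z :* (x :* y)) refl
archimedean K (mkℚ (ℤ.+ zero) _ _)  (ℚ.*<* (ℤ.+<+ ()))
archimedean K (mkℚ ℤ.-[1+ _ ] _ _) (ℚ.*<* ())

1≤ι-ι : ∀ {F H} → H + 1 ≤ F → 1ℚ ℚ.≤ ι F ℚ.- ι H
1≤ι-ι {F} {H} H+1≤F = begin
  1ℚ                 ≡⟨ x+k-x≡k (ι H) 1ℚ ⟨
  ι H ℚ.+ 1ℚ ℚ.- ι H ≡⟨ cong (ℚ._- ι H) (ι-homo-+ H 1) ⟨
  ι (H + 1) ℚ.- ι H  ≤⟨ ℚ.+-monoˡ-≤ (ℚ.- ι H) (ι-mono-≤ H+1≤F) ⟩
  ι F ℚ.- ι H        ∎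
  where open ℚ.≤-Reasoning

Kp≤εp²r : ∀ K p (ε r : ℚ) .{{_ : ℚ.NonNegative ε}} → ι K ℚ.≤ ε ℚ.* ι p → 1ℚ ℚ.≤ r →
         ι (K * p) ℚ.≤ ε ℚ.* (ι (p * p) ℚ.* r)
Kp≤εp²r K p ε r K≤εp 1≤r = begin
  ι (K * p)                  ≡⟨ ι-homo-* K p ⟩
  ι K ℚ.* ι p                ≤⟨ ℚ.*-monoʳ-≤-nonNeg (ι p) {{ι-nonNeg p}} K≤εp ⟩
  ε ℚ.* ι p ℚ.* ι p          ≡⟨ regroup ε (ι p) ⟩
  ε ℚ.* (ι p ℚ.* ι p ℚ.* 1ℚ) ≡⟨ cong (λ x → ε ℚ.* (x ℚ.* 1ℚ)) (ι-homo-* p p) ⟨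
  ε ℚ.* (ι (p * p) ℚ.* 1ℚ)   ≤⟨ ℚ.*-monoˡ-≤-nonNeg ε (ℚ.*-monoˡ-≤-nonNeg (ι (p * p)) {{ι-nonNeg (p * p)}} 1≤r) ⟩
  ε ℚ.* (ι (p * p) ℚ.* r)    ∎
  where
  open ℚ.≤-Reasoning
  regroup : ∀ ε p → ε ℚ.* p ℚ.* p ≡ ε ℚ.* (p ℚ.* p ℚ.* 1ℚ)
  regroup = solve 2 (λ ε p → ε :* p :* p := ε :* (p :* p :* con 1ℚ)) refl

theorem3p7 : (q₁ q₂ : ℕ) .{{_ : NonZero q₁}} .{{_ : NonZero q₂}} → q₁ ≢ q₂ →
    (ε : ℚ) → 0ℚ ℚ.< ε →
    ∃[ N ] ((p : ℕ) → Prime p → N ≤ p →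
      ℚ.∣ (ℤ.+ Ma q₁ q₂ p ℚ./ 1) ℚ.- (ℤ.+ (p * p) ℚ./ 1) ℚ.* mainConst q₁ q₂ ∣
        ℚ.≤ ε ℚ.* ((ℤ.+ (p * p) ℚ./ 1) ℚ.* mainConst q₁ q₂))
theorem3p7 q₁ q₂ q₁≢q₂ ε 0<ε = suc (q₁ + q₂) ⊔ N , λ p p-prime N′≤p →
  relative-error {Ma q₁ q₂ p} {p * p} {12 * q₁ * q₂} {8 * q₁ * q₂} {gcd q₁ q₂ * gcd q₁ q₂} {K * p}
    (mainConst q₁ q₂) ε {{D≢0}} (≈ᴷ p p-prime (m⊔n≤o⇒m≤o (suc (q₁ + q₂)) N N′≤p)) (mainConst-scaled q₁ q₂)
    (Kp≤εp²r K p ε _ {{ℚ.nonNegative (ℚ.<⇒≤ 0<ε)}} (K≤εp p (m⊔n≤o⇒n≤o (suc (q₁ + q₂)) N N′≤p))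
            (1≤ι-ι (gcd²<8q₁q₂ q₁ q₂)))
  where
  open Σ (Ma-asymptotic q₁ q₂ q₁≢q₂) renaming (proj₁ to K; proj₂ to ≈ᴷ)
  open Σ (archimedean K ε 0<ε) renaming (proj₁ to N; proj₂ to K≤εp)
  D≢0 : NonZero (12 * q₁ * q₂)
  D≢0 = m*n≢0 (12 * q₁) q₂ {{m*n≢0 12 q₁}}
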